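{- Let $G$ and $H$ be two finite bipartite graphs. Then $mp_f(G\square H)\geqslant mp_f(G)+\lfloor mp_f(H)\rfloor$, and equality holds when both $G$ and $H$ are regular.
   Context: The Cartesian product $G\square H$ has vertex set $V(G)\times V(H)$, with $(g,h)$ and $(g',h')$ adjacent iff either $g=g'$ and $hh'\in E(H)$, or $gg'\in E(G)$ and $h=h'$. For a graph $\Gamma$, let $\mathcal{M}(\Gamma)$ be its set of perfect matchings and $\bm{q}^M\in\mathbb{R}^{E(\Gamma)}$ the incidence vector of $M$; the fractional matching preclusion number $mp_f(\Gamma)$ is the optimal value of the linear program: minimize $\bm{1}^T\bm{y}$ over $\bm{y}\in\mathbb{R}^{E(\Gamma)}$ subject to $(\bm{q}^M)^T\bm{y}\geqslant 1$ for every $M\in\mathcal{M}(\Gamma)$ and $\bm{y}\geqslant 0$.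
   Formalization: The weight vectors $\bm{y}$ in the linear program defining $mp_f$ have rational entries rather than real ones. -}

module Defs where

open import Data.Nat using (ℕ; zero; suc) renaming (_*_ to _*ℕ_)
open import Data.Fin using (Fin; remQuot; _<_)
open import Data.Fin.Properties using (_≟_; _<?_)
open import Data.Bool using (Bool; true; false; _∧_; _∨_; if_then_else_)
open import Data.Bool.Properties using (∨-comm)
open import Data.List using (List; map; foldr; filter; length)
open import Data.List.Base using (allFin)
open import Data.Product using (Σ; _×_; _,_; proj₁; proj₂; ∃)
open import Data.Rational using (ℚ; 0ℚ; 1ℚ; _+_; _*_; _≤_)
open import Relation.Nullary using (Dec; yes; no; ¬_)
open import Relation.Nullary.Decidable using (⌊_⌋)
open import Relation.Binary.PropositionalEquality using (_≡_; _≢_; refl; sym; cong₂)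

record Graph : Set where
  field
    n      : ℕ
    adj    : Fin n → Fin n → Bool
    adj-sym    : ∀ u v → adj u v ≡ adj v u
    adj-irrefl : ∀ u → adj u u ≡ false
open Graph public

_==_ : ∀ {k} → Fin k → Fin k → Bool
i == j = ⌊ i ≟ j ⌋

==-sym : ∀ {k} (i j : Fin k) → (i == j) ≡ (j == i)
==-sym i j with i ≟ j | j ≟ i
... | yes _ | yes _ = refl
... | yes p | no ¬q = Data.Empty.⊥-elim (¬q (sym p))
  where import Data.Empty
... | no ¬p | yes q = Data.Empty.⊥-elim (¬p (sym q))
  where import Data.Empty
... | no _ | no _ = refl

==-refl : ∀ {k} (i : Fin k) → (i == i) ≡ true
==-refl i with i ≟ i
... | yes _ = refl
... | no ¬p = Data.Empty.⊥-elim (¬p refl)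
  where import Data.Empty

private
  pairAdj : (G H : Graph) → Fin (n G) × Fin (n H) → Fin (n G) × Fin (n H) → Bool
  pairAdj G H (g , h) (g' , h') = ((g == g') ∧ adj H h h') ∨ (adj G g g' ∧ (h == h'))

  pairSym : (G H : Graph) → ∀ p q → pairAdj G H p q ≡ pairAdj G H q p
  pairSym G H (g , h) (g' , h') =
    cong₂ _∨_ (cong₂ _∧_ (==-sym g g') (adj-sym H h h'))
              (cong₂ _∧_ (adj-sym G g g') (==-sym h h'))

  pairIrr : (G H : Graph) → ∀ p → pairAdj G H p p ≡ false
  pairIrr G H (g , h) rewrite ==-refl g | ==-refl h | adj-irrefl H h | adj-irrefl G g = refl

  □adj : (G H : Graph) → Fin (n G *ℕ n H) → Fin (n G *ℕ n H) → Bool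
  □adj G H x y = pairAdj G H (remQuot (n H) x) (remQuot (n H) y)

_□_ : Graph → Graph → Graph
G □ H = record
  { n = n G *ℕ n H
  ; adj = □adj G H
  ; adj-sym = λ x y → pairSym G H (remQuot (n H) x) (remQuot (n H) y)
  ; adj-irrefl = λ x → pairIrr G H (remQuot (n H) x)
  }

Σℚ : ∀ {k} → (Fin k → ℚ) → ℚ
Σℚ {k} f = foldr (λ i acc → f i + acc) 0ℚ (allFin k)

countB : ∀ {k} → (Fin k → Bool) → ℕ
countB {k} p = length (filter (λ i → Data.Bool.T? (p i)) (allFin k))
  where import Data.Bool

-- Each edge {u,v} is represented by the ordered pair with u < v.
lt : ∀ {k} → Fin k → Fin k → Bool
lt u v = ⌊ u <? v ⌋

isEdge : (Γ : Graph) → Fin (n Γ) → Fin (n Γ) → Bool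
isEdge Γ u v = lt u v ∧ adj Γ u v

degree : (Γ : Graph) → Fin (n Γ) → ℕ
degree Γ v = countB (adj Γ v)

Regular : Graph → Set
Regular Γ = ∃ λ (k : ℕ) → ∀ v → degree Γ v ≡ k

Bipartite : Graph → Set
Bipartite Γ = Σ (Fin (n Γ) → Bool) λ c →
  ∀ u v → adj Γ u v ≡ true → c u ≢ c v

-- A set of edges: a Boolean function, read only on pairs u < v.
EdgeSet : Graph → Set
EdgeSet Γ = Fin (n Γ) → Fin (n Γ) → Bool

memE : (Γ : Graph) → EdgeSet Γ → Fin (n Γ) → Fin (n Γ) → Bool
memE Γ M u v = (lt u v ∧ M u v) ∨ (lt v u ∧ M v u)

PerfectMatching : (Γ : Graph) → EdgeSet Γ → Set
PerfectMatching Γ M =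
  (∀ u v → lt u v ≡ true → M u v ≡ true → adj Γ u v ≡ true) ×
  (∀ v → countB (memE Γ M v) ≡ 1)

-- Weight vectors y ∈ ℚ^{E(Γ)}: y u v is the weight of edge {u,v}, u < v.
Weights : Graph → Set
Weights Γ = Fin (n Γ) → Fin (n Γ) → ℚ

sumOver : (Γ : Graph) → EdgeSet Γ → Weights Γ → ℚ
sumOver Γ S y = Σℚ λ u → Σℚ λ v →
  if lt u v ∧ S u v then y u v else 0ℚ

objective : (Γ : Graph) → Weights Γ → ℚ
objective Γ y = sumOver Γ (adj Γ) y

incidenceDot : (Γ : Graph) → EdgeSet Γ → Weights Γ → ℚ
incidenceDot Γ M y = sumOver Γ M y

Feasible : (Γ : Graph) → Weights Γ → Set
Feasible Γ y =
  (∀ u v → isEdge Γ u v ≡ true → 0ℚ ≤ y u v) ×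
  (∀ M → PerfectMatching Γ M → 1ℚ ≤ incidenceDot Γ M y)

IsMpf : (Γ : Graph) → ℚ → Set
IsMpf Γ r =
  (Σ (Weights Γ) λ y → Feasible Γ y × objective Γ y ≡ r) ×
  (∀ y → Feasible Γ y → r ≤ objective Γ y)

-- A feasible weighting y of G □ H projects to feasible weightings of G and H by summing y along
-- the fibres, because a perfect matching of either factor, copied into every fibre, is a perfect
-- matching of G □ H; the two projected objectives add up to the objective of y. Hence
-- mp_f(G □ H) ≥ mp_f(G) + mp_f(H) ≥ mp_f(G) + ⌊mp_f(H)⌋.
-- A d-regular bipartite graph has mp_f = d: the star of a vertex (weight 1 on its d edges) is
-- feasible, and by Hall's theorem the graph splits into d perfect matchings, each carrying weight
-- at least 1. For regular G and H the star of a vertex of G □ H, whose degree is d_G + d_H, gives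
-- the reverse inequality.

module Submission where

open import Defs
open import Algebra.Bundles using (CommutativeMonoid)
open import Data.Bool using (Bool; true; false; _∧_; _∨_; not; if_then_else_; T?)
import Data.Bool.Properties as 𝔹
open import Data.Empty using (⊥-elim)
open import Data.Fin as Fin using (Fin; zero; suc; combine; remQuot; _↑ˡ_; _↑ʳ_)
import Data.Fin.Properties as FinP
open import Data.Fin.Subset.Properties using (anySubset?)
import Data.Integer as ℤ
import Data.Integer.DivMod as ℤ
import Data.Integer.Properties as ℤP
open import Data.List using (foldr; filter; length)
import Data.List as List
open import Data.Nat as ℕ using (ℕ; zero; suc; s≤s)
import Data.Nat.DivMod as ℕ
open import Data.Nat.Induction using (<-rec)
import Data.Nat.Properties as ℕP
open import Data.Product using (Σ; _×_; _,_; proj₁; proj₂)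
open import Data.Rational using (ℚ; mkℚ; 0ℚ; 1ℚ; _+_; _≤_; _/_; floor; *≤*)
open import Data.Rational.Literals using (fromℤ)
import Data.Rational.Properties as ℚP
import Data.Sign as Sign
open import Data.Vec using (lookup; tabulate)
open import Data.Vec.Properties using (lookup∘tabulate)
open import Function using (_∘_; id; const)
open import Relation.Binary using (tri<; tri≈; tri>)
open import Relation.Binary.PropositionalEquality
  using (_≡_; _≢_; refl; sym; trans; cong; cong₂; subst; subst₂; module ≡-Reasoning)
open import Relation.Nullary using (yes; no; ¬_)
open import Relation.Nullary.Decidable using (Dec; _×-dec_; _→-dec_)

true≢false : true ≢ false
true≢false ()

∧≡true : ∀ {a b} → a ∧ b ≡ true → (a ≡ true) × (b ≡ true)
∧≡true {true} {true} _ = refl , refl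

==⇒≡ : ∀ {k} (i j : Fin k) → (i == j) ≡ true → i ≡ j
==⇒≡ i j eq with i FinP.≟ j
... | yes i≡j = i≡j

==-suc : ∀ {k} (i j : Fin k) → (suc i == suc j) ≡ (i == j)
==-suc i j with i FinP.≟ j
... | yes refl = refl
... | no _ = refl

module FinSum {c ℓ} (M : CommutativeMonoid c ℓ) where
  open CommutativeMonoid M
    using (Carrier; _≈_; setoid)
    renaming (_∙_ to _⊕_; ε to 0#; ∙-cong to ⊕-cong; identityˡ to ⊕-identityˡ; identityʳ to ⊕-identityʳ;
              assoc to ⊕-assoc; refl to ≈-refl; sym to ≈-sym; trans to ≈-trans)
  open import Algebra.Properties.CommutativeMonoid.Sum M public
  open import Relation.Binary.Reasoning.Setoid setoid

  sum-cong : ∀ {n} {f g : Fin n → Carrier} → (∀ i → f i ≈ g i) → sum f ≈ sum g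
  sum-cong = sum-cong-≋

  sum-zero : ∀ n → sum {n} (λ _ → 0#) ≈ 0#
  sum-zero = sum-replicate-zero

  sum-↑ : ∀ m k (f : Fin (m ℕ.+ k) → Carrier) → sum f ≈ sum (f ∘ (_↑ˡ k)) ⊕ sum (f ∘ (m ↑ʳ_))
  sum-↑ zero k f = ≈-sym (⊕-identityˡ (sum f))
  sum-↑ (suc m) k f = ≈-trans (⊕-cong ≈-refl (sum-↑ m k (f ∘ suc))) (≈-sym (⊕-assoc _ _ _))

  sum-combine : ∀ m k (f : Fin (m ℕ.* k) → Carrier) → sum f ≈ ∑[ g < m ] ∑[ h < k ] f (combine g h)
  sum-combine zero k f = ≈-refl
  sum-combine (suc m) k f = ≈-trans (sum-↑ k (m ℕ.* k) f) (⊕-cong ≈-refl (sum-combine m k (f ∘ (k ↑ʳ_))))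

  sum-if : ∀ {n} b (f : Fin n → Carrier) → ∑[ j < n ] (if b then f j else 0#) ≈ (if b then sum f else 0#)
  sum-if true f = ≈-refl
  sum-if {n} false f = sum-zero n

  sum-δ : ∀ {n} (i : Fin n) (f : Fin n → Carrier) → ∑[ j < n ] (if i == j then f j else 0#) ≈ f i
  sum-δ {suc n} zero f = ≈-trans (⊕-cong ≈-refl (sum-zero n)) (⊕-identityʳ (f zero))
  sum-δ {suc n} (suc i) f = begin
    0# ⊕ ∑[ j < n ] (if suc i == suc j then f (suc j) else 0#)
      ≈⟨ ⊕-identityˡ _ ⟩
    ∑[ j < n ] (if suc i == suc j then f (suc j) else 0#)
      ≡⟨ sum-cong-≗ (λ j → cong (λ b → if b then f (suc j) else 0#) (==-suc i j)) ⟩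
    ∑[ j < n ] (if i == j then f (suc j) else 0#)
      ≈⟨ sum-δ i (f ∘ suc) ⟩
    f (suc i) ∎

  sum-empty : ∀ {n} (f : Fin n → Carrier) → ¬ Fin n → sum f ≈ 0#
  sum-empty {zero} f _ = ≈-refl
  sum-empty {suc n} f ¬i = ⊥-elim (¬i zero)

  foldr-tabulate : ∀ {n k} (f : Fin k → Carrier) (g : Fin n → Fin k) →
    foldr (λ i acc → f i ⊕ acc) 0# (List.tabulate g) ≡ sum (f ∘ g)
  foldr-tabulate {zero} f g = refl
  foldr-tabulate {suc n} f g = cong (f (g zero) ⊕_) (foldr-tabulate f (g ∘ suc))

module ℚΣ = FinSum ℚP.+-0-commutativeMonoid
module ℕΣ = FinSum ℕP.+-0-commutativeMonoid
open ℚΣ using (sum-syntax) renaming (sum to ∑ℚ)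

Σℚ≡∑ : ∀ {n} (f : Fin n → ℚ) → Σℚ f ≡ ∑ℚ f
Σℚ≡∑ f = ℚΣ.foldr-tabulate f id

∑ℕ-mono-≤ : ∀ {n} {f g : Fin n → ℕ} → (∀ i → f i ℕ.≤ g i) → ℕΣ.sum f ℕ.≤ ℕΣ.sum g
∑ℕ-mono-≤ {zero} f≤g = ℕ.z≤n
∑ℕ-mono-≤ {suc n} f≤g = ℕP.+-mono-≤ (f≤g zero) (∑ℕ-mono-≤ (f≤g ∘ suc))

∑ℚ-mono-≤ : ∀ {n} {f g : Fin n → ℚ} → (∀ i → f i ≤ g i) → ∑ℚ f ≤ ∑ℚ g
∑ℚ-mono-≤ {zero} f≤g = ℚP.≤-refl
∑ℚ-mono-≤ {suc n} f≤g = ℚP.+-mono-≤ (f≤g zero) (∑ℚ-mono-≤ (f≤g ∘ suc))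

∑ℚ-nonNegative : ∀ {n} {f : Fin n → ℚ} → (∀ i → 0ℚ ≤ f i) → 0ℚ ≤ ∑ℚ f
∑ℚ-nonNegative {n} {f} 0≤f = subst (_≤ ∑ℚ f) (ℚΣ.sum-zero n) (∑ℚ-mono-≤ 0≤f)

𝟙 : Bool → ℕ
𝟙 b = if b then 1 else 0

𝟙-∧ˡ : ∀ a b → 𝟙 (a ∧ b) ≡ (if a then 𝟙 b else 0)
𝟙-∧ˡ true b = refl
𝟙-∧ˡ false b = refl

𝟙-∧ʳ : ∀ a b → 𝟙 (a ∧ b) ≡ (if b then 𝟙 a else 0)
𝟙-∧ʳ a true = cong 𝟙 (𝔹.∧-identityʳ a)
𝟙-∧ʳ a false = cong 𝟙 (𝔹.∧-zeroʳ a)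

count : ∀ {n} → (Fin n → Bool) → ℕ
count p = ℕΣ.sum (𝟙 ∘ p)

countB≡count : ∀ {n} (p : Fin n → Bool) → countB p ≡ count p
countB≡count p = go p id
  where
  go : ∀ {n k} (p : Fin k → Bool) (g : Fin n → Fin k) →
    length (filter (λ i → T? (p i)) (List.tabulate g)) ≡ count (p ∘ g)
  go {zero} p g = refl
  go {suc n} p g with p (g zero)
  ... | true = cong suc (go p (g ∘ suc))
  ... | false = go p (g ∘ suc)

degree≡count : ∀ Γ v → degree Γ v ≡ count (adj Γ v)
degree≡count Γ v = countB≡count (adj Γ v)

infix 4 _⊆_
infixl 6 _∖_
infixr 6 _∪_ _∩_

_⊆_ : ∀ {n} (p q : Fin n → Bool) → Set
p ⊆ q = ∀ i → p i ≡ true → q i ≡ true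

_∪_ _∩_ _∖_ : ∀ {n} (p q : Fin n → Bool) → Fin n → Bool
(p ∪ q) i = p i ∨ q i
(p ∩ q) i = p i ∧ q i
(p ∖ q) i = p i ∧ not (q i)

count-cong : ∀ {n} {p q : Fin n → Bool} → (∀ i → p i ≡ q i) → count p ≡ count q
count-cong p≗q = ℕΣ.sum-cong (cong 𝟙 ∘ p≗q)

count-false : ∀ {n} {p : Fin n → Bool} → (∀ i → p i ≡ false) → count p ≡ 0
count-false {n} p≗false = trans (count-cong p≗false) (ℕΣ.sum-zero n)

count-split : ∀ {n} (p q : Fin n → Bool) → count p ≡ count (p ∩ q) ℕ.+ count (p ∖ q)
count-split p q = trans (ℕΣ.sum-cong (λ i → split (p i) (q i))) (ℕΣ.∑-distrib-+ (𝟙 ∘ (p ∩ q)) (𝟙 ∘ (p ∖ q)))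
  where
  split : ∀ b c → 𝟙 b ≡ 𝟙 (b ∧ c) ℕ.+ 𝟙 (b ∧ not c)
  split true true = refl
  split true false = refl
  split false c = refl

count-∖ : ∀ {n} {p q : Fin n → Bool} → p ⊆ q → count q ≡ count p ℕ.+ count (q ∖ p)
count-∖ {p = p} {q} p⊆q = trans (count-split q p) (cong (ℕ._+ count (q ∖ p)) (count-cong q∩p≗p))
  where
  q∩p≗p : ∀ i → q i ∧ p i ≡ p i
  q∩p≗p i with p i in pi
  ... | true = cong (_∧ true) (p⊆q i pi)
  ... | false = 𝔹.∧-zeroʳ (q i)

count-∪ : ∀ {n} (p q : Fin n → Bool) → count (p ∪ q) ≡ count q ℕ.+ count (p ∖ q)
count-∪ p q = trans (count-∖ {p = q} {p ∪ q} (λ i qi → trans (cong (p i ∨_) qi) (𝔹.∨-zeroʳ (p i))))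
                    (cong (count q ℕ.+_) (count-cong minus))
  where
  minus : ∀ i → (p i ∨ q i) ∧ not (q i) ≡ p i ∧ not (q i)
  minus i with q i
  ... | true = trans (𝔹.∧-zeroʳ (p i ∨ true)) (sym (𝔹.∧-zeroʳ (p i)))
  ... | false = cong (_∧ true) (𝔹.∨-identityʳ (p i))

count-∪-disjoint : ∀ {n} (p q : Fin n → Bool) → (∀ i → p i ∧ q i ≡ false) → count (p ∪ q) ≡ count p ℕ.+ count q
count-∪-disjoint p q disjoint =
  trans (count-∪ p q) (trans (cong (count q ℕ.+_) (count-cong p∖q≗p)) (ℕP.+-comm (count q) (count p)))
  where
  p∖q≗p : ∀ i → p i ∧ not (q i) ≡ p i
  p∖q≗p i with p i in pi | q i in qi
  ... | true | true = ⊥-elim (true≢false (trans (sym (cong₂ _∧_ pi qi)) (disjoint i)))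
  ... | true | false = refl
  ... | false | _ = refl

count-mono : ∀ {n} {p q : Fin n → Bool} → p ⊆ q → count p ℕ.≤ count q
count-mono p⊆q = ∑ℕ-mono-≤ (λ i → mono (p⊆q i))
  where
  mono : ∀ {b c} → (b ≡ true → c ≡ true) → 𝟙 b ℕ.≤ 𝟙 c
  mono {false} _ = ℕ.z≤n
  mono {true} b⇒c rewrite b⇒c refl = ℕP.≤-refl

count≡0⇒false : ∀ {n} (p : Fin n → Bool) → count p ≡ 0 → ∀ i → p i ≡ false
count≡0⇒false {suc n} p eq i with p zero in p0
count≡0⇒false {suc n} p eq zero | false = p0
count≡0⇒false {suc n} p eq (suc i) | false = count≡0⇒false (p ∘ suc) eq i

count>0⇒witness : ∀ {n} (p : Fin n → Bool) → 1 ℕ.≤ count p → Σ (Fin n) λ i → p i ≡ true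
count>0⇒witness {suc n} p pos with p zero in p0
... | true = zero , p0
... | false with count>0⇒witness (p ∘ suc) pos
... | i , pi = suc i , pi

count-unique : ∀ {n} (p : Fin n → Bool) (i : Fin n) → p i ≡ true → (∀ j → p j ≡ true → j ≡ i) → count p ≡ 1
count-unique p i pi unique = trans (count-cong p≗δ) (ℕΣ.sum-δ i (λ _ → 1))
  where
  p≗δ : ∀ j → p j ≡ (i == j)
  p≗δ j with p j in pj | i FinP.≟ j
  ... | true | yes _ = refl
  ... | true | no i≢j = ⊥-elim (i≢j (sym (unique j pj)))
  ... | false | yes refl = trans (sym pj) pi
  ... | false | no _ = refl

count-δ : ∀ {n} (i : Fin n) → count (i ==_) ≡ 1
count-δ i = count-unique (i ==_) i (==-refl i) (λ j i==j → sym (==⇒≡ i j i==j))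

δ⊆ : ∀ {n} {p : Fin n → Bool} {i} → p i ≡ true → (i ==_) ⊆ p
δ⊆ {p = p} {i} pi j i==j = subst (λ k → p k ≡ true) (==⇒≡ i j i==j) pi

count-∖-δ : ∀ {n} {p : Fin n → Bool} {i} → p i ≡ true → count p ≡ suc (count (p ∖ (i ==_)))
count-∖-δ {p = p} {i} pi = trans (count-∖ {q = p} (δ⊆ pi)) (cong (ℕ._+ count (p ∖ (i ==_))) (count-δ i))

count≤1 : ∀ {n} (p : Fin n → Bool) → (∀ i j → p i ≡ true → p j ≡ true → i ≡ j) → count p ℕ.≤ 1
count≤1 p atMostOne with 1 ℕ.≤? count p
... | no ¬pos = ℕP.<⇒≤ (ℕP.≰⇒> ¬pos)
... | yes pos with count>0⇒witness p pos
... | i , pi = ℕP.≤-reflexive (count-unique p i pi (λ j pj → atMostOne j i pj pi))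

⊆∧count≥⇒⊇ : ∀ {n} {p q : Fin n → Bool} → p ⊆ q → count q ℕ.≤ count p → q ⊆ p
⊆∧count≥⇒⊇ {p = p} {q} p⊆q q≤p i qi with p i in pi
... | true = refl
... | false = ⊥-elim (true≢false (trans (sym q∖p-i) (count≡0⇒false (q ∖ p) q∖p≡0 i)))
  where
  q∖p≡0 : count (q ∖ p) ≡ 0
  q∖p≡0 = ℕP.n≤0⇒n≡0 (ℕP.+-cancelˡ-≤ (count p) (count (q ∖ p)) 0
    (subst₂ ℕ._≤_ (count-∖ p⊆q) (sym (ℕP.+-identityʳ (count p))) q≤p))
  q∖p-i : q i ∧ not (p i) ≡ true
  q∖p-i rewrite qi | pi = refl

anyᵇ : ∀ {n} → (Fin n → Bool) → Bool
anyᵇ {zero} p = false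
anyᵇ {suc n} p = p zero ∨ anyᵇ (p ∘ suc)

anyᵇ-intro : ∀ {n} (p : Fin n → Bool) i → p i ≡ true → anyᵇ p ≡ true
anyᵇ-intro p zero pi rewrite pi = refl
anyᵇ-intro p (suc i) pi rewrite anyᵇ-intro (p ∘ suc) i pi = 𝔹.∨-zeroʳ (p zero)

anyᵇ-witness : ∀ {n} (p : Fin n → Bool) → anyᵇ p ≡ true → Σ (Fin n) λ i → p i ≡ true
anyᵇ-witness {suc n} p any with p zero in p0
... | true = zero , p0
... | false with anyᵇ-witness (p ∘ suc) any
... | i , pi = suc i , pi

anyᵇ≡false : ∀ {n} (p : Fin n → Bool) → anyᵇ p ≡ false → ∀ i → p i ≡ false
anyᵇ≡false p none i with p i in pi
... | false = refl
... | true = trans (sym (anyᵇ-intro p i pi)) none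

anyᵇ-cong : ∀ {n} {p q : Fin n → Bool} → (∀ i → p i ≡ q i) → anyᵇ p ≡ anyᵇ q
anyᵇ-cong {zero} p≗q = refl
anyᵇ-cong {suc n} p≗q = cong₂ _∨_ (p≗q zero) (anyᵇ-cong (p≗q ∘ suc))

anyᵇ-∪ : ∀ {n} (p q : Fin n → Bool) → anyᵇ (p ∪ q) ≡ anyᵇ p ∨ anyᵇ q
anyᵇ-∪ {zero} p q = refl
anyᵇ-∪ {suc n} p q rewrite anyᵇ-∪ (p ∘ suc) (q ∘ suc) = interchange (p zero) (q zero) _ _
  where
  interchange : ∀ a b c d → (a ∨ b) ∨ (c ∨ d) ≡ (a ∨ c) ∨ (b ∨ d)
  interchange true b c d = refl
  interchange false true c d = sym (𝔹.∨-zeroʳ c)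
  interchange false false c d = refl

anyᵇ-∧ʳ : ∀ {n} (p : Fin n → Bool) b → anyᵇ (λ i → p i ∧ b) ≡ anyᵇ p ∧ b
anyᵇ-∧ʳ {zero} p b = refl
anyᵇ-∧ʳ {suc n} p b rewrite anyᵇ-∧ʳ (p ∘ suc) b = sym (𝔹.∧-distribʳ-∨ b (p zero) (anyᵇ (p ∘ suc)))

module Hall {n : ℕ} where

  Pred : Set
  Pred = Fin n → Bool

  Rel : Set
  Rel = Fin n → Fin n → Bool

  _⊖_ : Rel → Pred → Rel
  (nbr ⊖ D) i j = nbr i j ∧ not (D j)

  neighbours : Rel → Pred → Pred
  neighbours nbr S j = anyᵇ (λ i → S i ∧ nbr i j)

  HallCondition : Pred → Rel → Set
  HallCondition L nbr = ∀ S → S ⊆ L → count S ℕ.≤ count (neighbours nbr S)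

  Represents : Pred → Rel → (Fin n → Fin n) → Set
  Represents L nbr f = (∀ i → L i ≡ true → nbr i (f i) ≡ true) ×
                       (∀ i j → L i ≡ true → L j ≡ true → f i ≡ f j → i ≡ j)

  DistinctRepresentatives : Pred → Rel → Set
  DistinctRepresentatives L nbr = Σ (Fin n → Fin n) (Represents L nbr)

  neighbours-⊖ : ∀ nbr D T j → neighbours (nbr ⊖ D) T j ≡ (neighbours nbr T ∖ D) j
  neighbours-⊖ nbr D T j =
    trans (anyᵇ-cong (λ i → sym (𝔹.∧-assoc (T i) (nbr i j) (not (D j)))))
          (anyᵇ-∧ʳ (λ i → T i ∧ nbr i j) (not (D j)))

  count-neighbours-⊖ : ∀ nbr D T →
    count (neighbours nbr T) ≡ count (neighbours nbr T ∩ D) ℕ.+ count (neighbours (nbr ⊖ D) T)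
  count-neighbours-⊖ nbr D T =
    trans (count-split (neighbours nbr T) D)
          (cong (count (neighbours nbr T ∩ D) ℕ.+_) (count-cong (sym ∘ neighbours-⊖ nbr D T)))

  neighbours-∪ : ∀ nbr T S j → neighbours nbr (T ∪ S) j ≡ (neighbours nbr T ∪ neighbours nbr S) j
  neighbours-∪ nbr T S j =
    trans (anyᵇ-cong (λ i → 𝔹.∧-distribʳ-∨ (nbr i j) (T i) (S i)))
          (anyᵇ-∪ (λ i → T i ∧ nbr i j) (λ i → S i ∧ nbr i j))

  represents-glue : ∀ {L S nbr D} (f₁ f₂ : Fin n → Fin n) →
    Represents S nbr f₁ → (∀ i → S i ≡ true → D (f₁ i) ≡ true) → Represents (L ∖ S) (nbr ⊖ D) f₂ →
    Represents L nbr (λ i → if S i then f₁ i else f₂ i)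
  represents-glue {L} {S} {nbr} {D} f₁ f₂ (adj₁ , inj₁) f₁∈D (adj₂ , inj₂) = adjacent , injective
    where
    ∈L∖S : ∀ i → L i ≡ true → S i ≡ false → (L ∖ S) i ≡ true
    ∈L∖S i Li Si = cong₂ _∧_ Li (cong not Si)
    f₂∉D : ∀ i → L i ≡ true → S i ≡ false → D (f₂ i) ≡ false
    f₂∉D i Li Si = 𝔹.not-injective (proj₂ (∧≡true (adj₂ i (∈L∖S i Li Si))))
    adjacent : ∀ i → L i ≡ true → nbr i (if S i then f₁ i else f₂ i) ≡ true
    adjacent i Li with S i in Si
    ... | true = adj₁ i Si
    ... | false = proj₁ (∧≡true (adj₂ i (∈L∖S i Li Si)))
    crossing : ∀ i j → S i ≡ true → L j ≡ true → S j ≡ false → f₁ i ≢ f₂ j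
    crossing i j Si Lj Sj f₁i≡f₂j = true≢false (trans (sym (f₁∈D i Si)) (trans (cong D f₁i≡f₂j) (f₂∉D j Lj Sj)))
    injective : ∀ i j → L i ≡ true → L j ≡ true →
      (if S i then f₁ i else f₂ i) ≡ (if S j then f₁ j else f₂ j) → i ≡ j
    injective i j Li Lj eq with S i in Si | S j in Sj
    ... | true | true = inj₁ i j Si Sj eq
    ... | true | false = ⊥-elim (crossing i j Si Lj Sj eq)
    ... | false | true = ⊥-elim (crossing j i Sj Li Si (sym eq))
    ... | false | false = inj₂ i j (∈L∖S i Li Si) (∈L∖S j Lj Sj) eq

  hallCondition-∖-tight : ∀ {L S nbr} → HallCondition L nbr → S ⊆ L → count (neighbours nbr S) ℕ.≤ count S →
    HallCondition (L ∖ S) (nbr ⊖ neighbours nbr S)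
  hallCondition-∖-tight {L} {S} {nbr} hall S⊆L tight T T⊆L∖S = ℕP.+-cancelˡ-≤ (count S) _ _ (begin
    count S ℕ.+ count T                          ≡⟨ cong (count S ℕ.+_) (count-cong T∖S≗T) ⟨
    count S ℕ.+ count (T ∖ S)                    ≡⟨ count-∪ T S ⟨
    count (T ∪ S)                                ≤⟨ hall (T ∪ S) T∪S⊆L ⟩
    count (neighbours nbr (T ∪ S))               ≡⟨ count-cong (neighbours-∪ nbr T S) ⟩
    count (neighbours nbr T ∪ NS)                ≡⟨ count-∪ (neighbours nbr T) NS ⟩
    count NS ℕ.+ count (neighbours nbr T ∖ NS)   ≡⟨ cong (count NS ℕ.+_) (count-cong (sym ∘ neighbours-⊖ nbr NS T)) ⟩
    count NS ℕ.+ count (neighbours (nbr ⊖ NS) T) ≤⟨ ℕP.+-monoˡ-≤ _ tight ⟩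
    count S ℕ.+ count (neighbours (nbr ⊖ NS) T)  ∎)
    where
    open ℕP.≤-Reasoning
    NS = neighbours nbr S
    T∖S≗T : ∀ i → (T ∖ S) i ≡ T i
    T∖S≗T i with T i in Ti
    ... | true = proj₂ (∧≡true (T⊆L∖S i Ti))
    ... | false = refl
    T∪S⊆L : T ∪ S ⊆ L
    T∪S⊆L i T∪Si with T i in Ti
    ... | true = proj₁ (∧≡true (T⊆L∖S i Ti))
    ... | false = S⊆L i T∪Si

  hallCondition-∖-loose : ∀ {L nbr x y} → HallCondition L nbr → L x ≡ true →
    (∀ T → T ⊆ L → 1 ℕ.≤ count T → count T ℕ.< count L → count T ℕ.< count (neighbours nbr T)) →
    HallCondition (L ∖ (x ==_)) (nbr ⊖ (y ==_))
  hallCondition-∖-loose {L} {nbr} {x} {y} hall Lx loose T T⊆L∖x with 1 ℕ.≤? count T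
  ... | no ¬pos = ℕP.≤-trans (ℕP.≮⇒≥ λ pos → ¬pos pos) ℕ.z≤n
  ... | yes pos = ℕP.≤-pred (begin-strict
    count T                                  <⟨ loose T T⊆L pos T<L ⟩
    count (neighbours nbr T)                 ≡⟨ count-neighbours-⊖ nbr (y ==_) T ⟩
    count (neighbours nbr T ∩ (y ==_)) ℕ.+ count (neighbours (nbr ⊖ (y ==_)) T)
                                             ≤⟨ ℕP.+-monoˡ-≤ _ atMostY ⟩
    suc (count (neighbours (nbr ⊖ (y ==_)) T)) ∎)
    where
    open ℕP.≤-Reasoning
    T⊆L : T ⊆ L
    T⊆L i Ti = proj₁ (∧≡true (T⊆L∖x i Ti))
    T<L : count T ℕ.< count L
    T<L = ℕP.≤-trans (s≤s (count-mono T⊆L∖x)) (ℕP.≤-reflexive (sym (count-∖-δ {p = L} Lx)))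
    atMostY : count (neighbours nbr T ∩ (y ==_)) ℕ.≤ 1
    atMostY = ℕP.≤-trans (count-mono {q = y ==_} (λ j → proj₂ ∘ ∧≡true {neighbours nbr T j}))
                         (ℕP.≤-reflexive (count-δ y))

  Tight : Pred → Rel → Pred → Set
  Tight L nbr S = S ⊆ L × 1 ℕ.≤ count S × count S ℕ.< count L × count (neighbours nbr S) ℕ.≤ count S

  tight? : ∀ L nbr S → Dec (Tight L nbr S)
  tight? L nbr S = FinP.all? (λ i → (S i 𝔹.≟ true) →-dec (L i 𝔹.≟ true))
    ×-dec 1 ℕ.≤? count S ×-dec count S ℕ.<? count L ×-dec count (neighbours nbr S) ℕ.≤? count S

  tight-cong : ∀ {L nbr S S′} → (∀ i → S i ≡ S′ i) → Tight L nbr S → Tight L nbr S′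
  tight-cong {L} {nbr} S≗S′ (S⊆L , pos , S<L , N≤S) =
    (λ i S′i → S⊆L i (trans (S≗S′ i) S′i)) ,
    subst (1 ℕ.≤_) |S|≡|S′| pos ,
    subst (ℕ._< count L) |S|≡|S′| S<L ,
    subst₂ ℕ._≤_ (count-cong (λ j → anyᵇ-cong (λ i → cong (_∧ nbr i j) (S≗S′ i)))) |S|≡|S′| N≤S
    where
    |S|≡|S′| = count-cong S≗S′

  neighbour-of : ∀ {L nbr x} → HallCondition L nbr → L x ≡ true → Σ (Fin n) λ y → nbr x y ≡ true
  neighbour-of {L} {nbr} {x} hall Lx = y , subst (λ i → nbr i y ≡ true) (sym (==⇒≡ x i x==i)) iy
    where
    hasNeighbour = count>0⇒witness (neighbours nbr (x ==_))
      (subst (ℕ._≤ count (neighbours nbr (x ==_))) (count-δ x) (hall (x ==_) (δ⊆ Lx)))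
    y = proj₁ hasNeighbour
    source = anyᵇ-witness (λ i → (x == i) ∧ nbr i y) (proj₂ hasNeighbour)
    i = proj₁ source
    x==i = proj₁ (∧≡true (proj₂ source))
    iy = proj₂ (∧≡true (proj₂ source))

  represents-empty : ∀ {L nbr} → count L ≡ 0 → Represents L nbr id
  represents-empty {L} empty = (λ i Li → ⊥-elim (∉ i Li)) , (λ i _ Li _ _ → ⊥-elim (∉ i Li))
    where
    ∉ : ∀ i → L i ≢ true
    ∉ i Li = true≢false (trans (sym Li) (count≡0⇒false L empty i))

  represents-singleton : ∀ {nbr x y} → nbr x y ≡ true → Represents (x ==_) nbr (const y)
  represents-singleton {nbr} {x} {y} xy =
    (λ i x==i → subst (λ j → nbr j y ≡ true) (==⇒≡ x i x==i) xy) ,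
    (λ i j x==i x==j _ → trans (sym (==⇒≡ x i x==i)) (==⇒≡ x j x==j))

  HallBelow : Pred → Set
  HallBelow L = ∀ L′ nbr′ → count L′ ℕ.< count L → HallCondition L′ nbr′ → DistinctRepresentatives L′ nbr′

  hall-tight : ∀ {L nbr S} → HallCondition L nbr → HallBelow L → Tight L nbr S → DistinctRepresentatives L nbr
  hall-tight {L} {nbr} {S} hallL rec (S⊆L , pos , S<L , tight) =
    _ , represents-glue {L} {S} {nbr} {neighbours nbr S} (proj₁ sdr₁) (proj₁ sdr₂)
          (proj₂ sdr₁) f₁∈NS (proj₂ sdr₂)
    where
    sdr₁ = rec S nbr S<L (λ T T⊆S → hallL T (λ i → S⊆L i ∘ T⊆S i))
    f₁∈NS : ∀ i → S i ≡ true → neighbours nbr S (proj₁ sdr₁ i) ≡ true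
    f₁∈NS i Si = anyᵇ-intro _ i (cong₂ _∧_ Si (proj₁ (proj₂ sdr₁) i Si))
    L∖S<L : count (L ∖ S) ℕ.< count L
    L∖S<L = ℕP.≤-trans (ℕP.+-monoˡ-≤ (count (L ∖ S)) pos) (ℕP.≤-reflexive (sym (count-∖ S⊆L)))
    sdr₂ = rec (L ∖ S) (nbr ⊖ neighbours nbr S) L∖S<L (hallCondition-∖-tight hallL S⊆L tight)

  hall-loose : ∀ {L nbr} → HallCondition L nbr → HallBelow L → count L ≢ 0 → (∀ S → ¬ Tight L nbr S) →
    DistinctRepresentatives L nbr
  hall-loose {L} {nbr} hallL rec nonempty noTight =
    _ , represents-glue {L} {x ==_} {nbr} {y ==_} (const y) (proj₁ sdr)
          (represents-singleton {nbr} xy) (λ _ _ → ==-refl y) (proj₂ sdr)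
    where
    element = count>0⇒witness L (ℕP.n≢0⇒n>0 nonempty)
    x = proj₁ element
    y = proj₁ (neighbour-of hallL (proj₂ element))
    xy = proj₂ (neighbour-of hallL (proj₂ element))
    loose : ∀ T → T ⊆ L → 1 ℕ.≤ count T → count T ℕ.< count L → count T ℕ.< count (neighbours nbr T)
    loose T T⊆L pos T<L = ℕP.≰⇒> (λ N≤T → noTight T (T⊆L , pos , T<L , N≤T))
    sdr = rec (L ∖ (x ==_)) (nbr ⊖ (y ==_)) (ℕP.≤-reflexive (sym (count-∖-δ {p = L} (proj₂ element))))
              (hallCondition-∖-loose hallL (proj₂ element) loose)

  -- Halmos–Vaughan: if some nonempty proper S ⊆ L has |N(S)| = |S|, represent S inside N(S) and
  -- L ∖ S outside it; otherwise send any x ∈ L to any neighbour y and recurse on L ∖ {x} without y.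
  hall : ∀ L nbr → HallCondition L nbr → DistinctRepresentatives L nbr
  hall L nbr = <-rec P step (count L) L nbr refl
    where
    P : ℕ → Set
    P m = ∀ L nbr → count L ≡ m → HallCondition L nbr → DistinctRepresentatives L nbr
    step : ∀ m → (∀ {k} → k ℕ.< m → P k) → P m
    step _ rec L nbr refl hallL with count L ℕ.≟ 0 | anySubset? (λ S → tight? L nbr (lookup S))
    ... | yes empty | _ = id , represents-empty {L} {nbr} empty
    ... | no _ | yes (S , tight) = hall-tight hallL (λ L′ nbr′ lt → rec lt L′ nbr′ refl) tight
    ... | no nonempty | no noTight = hall-loose hallL (λ L′ nbr′ lt → rec lt L′ nbr′ refl) nonempty
          (λ S tight → noTight (tabulate S , tight-cong (sym ∘ lookup∘tabulate S) tight))

open Hall using (HallCondition; neighbours; hall)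

toℚ : ℕ → ℚ
toℚ k = fromℤ (ℤ.+ k)

toℚ-+ : ∀ m k → toℚ (m ℕ.+ k) ≡ toℚ m + toℚ k
toℚ-+ m k = sym (trans (ℚP./-cong {p₂ = ℤ.+ (m ℕ.+ k)} {q₂ = 1} numerator refl) (ℚP.↥p/↧p≡p (toℚ (m ℕ.+ k))))
  where
  numerator : ℤ.+ m ℤ.* ℤ.+ 1 ℤ.+ ℤ.+ k ℤ.* ℤ.+ 1 ≡ ℤ.+ (m ℕ.+ k)
  numerator = cong₂ ℤ._+_ (ℤP.*-identityʳ (ℤ.+ m)) (ℤP.*-identityʳ (ℤ.+ k))

toℚ-sum : ∀ {n} (f : Fin n → ℕ) → toℚ (ℕΣ.sum f) ≡ ∑ℚ (toℚ ∘ f)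
toℚ-sum {zero} f = refl
toℚ-sum {suc n} f = trans (toℚ-+ (f zero) _) (cong (toℚ (f zero) +_) (toℚ-sum (f ∘ suc)))

lt-true : ∀ {k} {u v : Fin k} → u Fin.< v → lt u v ≡ true
lt-true {u = u} {v} u<v with u FinP.<? v
... | yes _ = refl
... | no u≮v = ⊥-elim (u≮v u<v)

lt-false : ∀ {k} {u v : Fin k} → ¬ u Fin.< v → lt u v ≡ false
lt-false {u = u} {v} u≮v with u FinP.<? v
... | yes u<v = ⊥-elim (u≮v u<v)
... | no _ = refl

lt-sound : ∀ {k} {u v : Fin k} → lt u v ≡ true → u Fin.< v
lt-sound {u = u} {v} uv with u FinP.<? v
... | yes u<v = u<v

lt-irrefl : ∀ {k} (u : Fin k) → lt u u ≡ false
lt-irrefl u = lt-false (FinP.<-irrefl refl)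

lt-asym : ∀ {k} (u v : Fin k) → lt u v ≡ true → lt v u ≡ false
lt-asym u v uv = lt-false (FinP.<-asym (lt-sound uv))

memE-sym : ∀ Γ (M : EdgeSet Γ) u v → memE Γ M u v ≡ memE Γ M v u
memE-sym Γ M u v = 𝔹.∨-comm (lt u v ∧ M u v) (lt v u ∧ M v u)

memE-irrefl : ∀ Γ (M : EdgeSet Γ) v → memE Γ M v v ≡ false
memE-irrefl Γ M v rewrite lt-irrefl v = refl

lt⇒memE : ∀ Γ (M : EdgeSet Γ) u v → lt u v ≡ true → memE Γ M u v ≡ M u v
lt⇒memE Γ M u v uv rewrite uv | lt-asym u v uv = 𝔹.∨-identityʳ (M u v)

memE-symmetric : ∀ Γ (M : EdgeSet Γ) → (∀ u v → M u v ≡ M v u) → (∀ v → M v v ≡ false) →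
  ∀ u v → memE Γ M u v ≡ M u v
memE-symmetric Γ M M-sym M-irrefl u v with FinP.<-cmp u v
... | tri< u<v _ _ = lt⇒memE Γ M u v (lt-true u<v)
... | tri≈ _ refl _ = trans (memE-irrefl Γ M u) (sym (M-irrefl u))
... | tri> _ _ v<u = trans (memE-sym Γ M u v) (trans (lt⇒memE Γ M v u (lt-true v<u)) (M-sym v u))

edgeTerm : (Γ : Graph) → EdgeSet Γ → Weights Γ → Fin (n Γ) → Fin (n Γ) → ℚ
edgeTerm Γ S y u v = if lt u v ∧ S u v then y u v else 0ℚ

edgeTerm-cong : ∀ Γ {S T : EdgeSet Γ} y u v → S u v ≡ T u v → edgeTerm Γ S y u v ≡ edgeTerm Γ T y u v
edgeTerm-cong Γ y u v S≡T = cong (λ b → if lt u v ∧ b then y u v else 0ℚ) S≡T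

sumOver≡∑ : ∀ Γ S y → sumOver Γ S y ≡ ∑[ u < n Γ ] ∑[ v < n Γ ] edgeTerm Γ S y u v
sumOver≡∑ Γ S y =
  trans (Σℚ≡∑ (λ u → Σℚ (edgeTerm Γ S y u))) (ℚΣ.sum-cong (λ u → Σℚ≡∑ (edgeTerm Γ S y u)))

sumOver-cong : ∀ Γ {S T : EdgeSet Γ} y → (∀ u v → lt u v ≡ true → S u v ≡ T u v) → sumOver Γ S y ≡ sumOver Γ T y
sumOver-cong Γ {S} {T} y S≗T = begin
  sumOver Γ S y                                ≡⟨ sumOver≡∑ Γ S y ⟩
  ∑[ u < n Γ ] ∑[ v < n Γ ] edgeTerm Γ S y u v ≡⟨ ℚΣ.sum-cong (λ u → ℚΣ.sum-cong (term u)) ⟩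
  ∑[ u < n Γ ] ∑[ v < n Γ ] edgeTerm Γ T y u v ≡⟨ sumOver≡∑ Γ T y ⟨
  sumOver Γ T y ∎
  where
  open ≡-Reasoning
  term : ∀ u v → edgeTerm Γ S y u v ≡ edgeTerm Γ T y u v
  term u v with lt u v in uv
  ... | true = cong (λ b → if b then y u v else 0ℚ) (S≗T u v uv)
  ... | false = refl

sumOver-∨ : ∀ Γ (S T : EdgeSet Γ) y → (∀ u v → S u v ∧ T u v ≡ false) →
  sumOver Γ (λ u v → S u v ∨ T u v) y ≡ sumOver Γ S y + sumOver Γ T y
sumOver-∨ Γ S T y disjoint = begin
  sumOver Γ (λ u v → S u v ∨ T u v) y
    ≡⟨ sumOver≡∑ Γ _ y ⟩
  ∑[ u < n Γ ] ∑[ v < n Γ ] edgeTerm Γ (λ u v → S u v ∨ T u v) y u v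
    ≡⟨ ℚΣ.sum-cong (λ u → trans (ℚΣ.sum-cong (term u)) (ℚΣ.∑-distrib-+ (edgeTerm Γ S y u) (edgeTerm Γ T y u))) ⟩
  ∑[ u < n Γ ] (∑[ v < n Γ ] edgeTerm Γ S y u v + ∑[ v < n Γ ] edgeTerm Γ T y u v)
    ≡⟨ ℚΣ.∑-distrib-+ (λ u → ∑[ v < n Γ ] edgeTerm Γ S y u v) (λ u → ∑[ v < n Γ ] edgeTerm Γ T y u v) ⟩
  ∑[ u < n Γ ] ∑[ v < n Γ ] edgeTerm Γ S y u v + ∑[ u < n Γ ] ∑[ v < n Γ ] edgeTerm Γ T y u v
    ≡⟨ cong₂ _+_ (sumOver≡∑ Γ S y) (sumOver≡∑ Γ T y) ⟨
  sumOver Γ S y + sumOver Γ T y ∎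
  where
  open ≡-Reasoning
  term : ∀ u v → edgeTerm Γ (λ u v → S u v ∨ T u v) y u v ≡ edgeTerm Γ S y u v + edgeTerm Γ T y u v
  term u v with lt u v | S u v in Suv | T u v in Tuv
  ... | false | _ | _ = sym (ℚP.+-identityˡ 0ℚ)
  ... | true | true | true = ⊥-elim (true≢false (trans (sym (cong₂ _∧_ Suv Tuv)) (disjoint u v)))
  ... | true | true | false = sym (ℚP.+-identityʳ (y u v))
  ... | true | false | true = sym (ℚP.+-identityˡ (y u v))
  ... | true | false | false = sym (ℚP.+-identityˡ 0ℚ)

objective-nonNegative : ∀ Γ y → Feasible Γ y → 0ℚ ≤ objective Γ y
objective-nonNegative Γ y (nonNegative , _) =
  subst (0ℚ ≤_) (sym (sumOver≡∑ Γ (adj Γ) y)) (∑ℚ-nonNegative λ u → ∑ℚ-nonNegative (term u))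
  where
  term : ∀ u v → 0ℚ ≤ edgeTerm Γ (adj Γ) y u v
  term u v with lt u v ∧ adj Γ u v in edge
  ... | true = nonNegative u v edge
  ... | false = ℚP.≤-refl

deleteEdges : (Γ : Graph) → EdgeSet Γ → Graph
deleteEdges Γ M = record
  { n = n Γ
  ; adj = λ u v → adj Γ u v ∧ not (memE Γ M u v)
  ; adj-sym = λ u v → cong₂ _∧_ (adj-sym Γ u v) (cong not (memE-sym Γ M u v))
  ; adj-irrefl = λ u → cong (_∧ not (memE Γ M u u)) (adj-irrefl Γ u)
  }

perfectMatching⇒adj : ∀ Γ {M} → PerfectMatching Γ M → ∀ u v → memE Γ M u v ≡ true → adj Γ u v ≡ true
perfectMatching⇒adj Γ {M} (inΓ , _) u v uv with FinP.<-cmp u v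
... | tri< u<v _ _ = inΓ u v (lt-true u<v) (trans (sym (lt⇒memE Γ M u v (lt-true u<v))) uv)
... | tri≈ _ refl _ = ⊥-elim (true≢false (trans (sym uv) (memE-irrefl Γ M u)))
... | tri> _ _ v<u = trans (adj-sym Γ u v)
  (inΓ v u (lt-true v<u) (trans (sym (lt⇒memE Γ M v u (lt-true v<u))) (trans (memE-sym Γ M v u) uv)))

module _ (Γ : Graph) {M : EdgeSet Γ} (matching : PerfectMatching Γ M) where

  private
    Γ∖M = deleteEdges Γ M

  adj-deleteEdges : ∀ u v → adj Γ u v ≡ memE Γ M u v ∨ adj Γ∖M u v
  adj-deleteEdges u v with memE Γ M u v in uv
  ... | true = perfectMatching⇒adj Γ matching u v uv
  ... | false = sym (𝔹.∧-identityʳ (adj Γ u v))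

  objective-deleteEdges : ∀ y → objective Γ y ≡ incidenceDot Γ M y + objective Γ∖M y
  objective-deleteEdges y = begin
    sumOver Γ (adj Γ) y
      ≡⟨ sumOver-cong Γ y (λ u v _ → adj-deleteEdges u v) ⟩
    sumOver Γ (λ u v → memE Γ M u v ∨ adj Γ∖M u v) y
      ≡⟨ sumOver-∨ Γ (memE Γ M) (adj Γ∖M) y disjoint ⟩
    sumOver Γ (memE Γ M) y + sumOver Γ (adj Γ∖M) y
      ≡⟨ cong (_+ objective Γ∖M y) (sumOver-cong Γ y (lt⇒memE Γ M)) ⟩
    sumOver Γ M y + objective Γ∖M y ∎
    where
    open ≡-Reasoning
    disjoint : ∀ u v → memE Γ M u v ∧ adj Γ∖M u v ≡ false
    disjoint u v with memE Γ M u v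
    ... | true = 𝔹.∧-zeroʳ (adj Γ u v)
    ... | false = refl

  degree-deleteEdges : ∀ v → degree Γ v ≡ suc (degree Γ∖M v)
  degree-deleteEdges v = begin
    degree Γ v                                         ≡⟨ degree≡count Γ v ⟩
    count (adj Γ v)                                    ≡⟨ count-split (adj Γ v) (memE Γ M v) ⟩
    count (adj Γ v ∩ memE Γ M v) ℕ.+ count (adj Γ∖M v) ≡⟨ cong (ℕ._+ count (adj Γ∖M v)) (count-cong matched) ⟩
    count (memE Γ M v) ℕ.+ count (adj Γ∖M v)           ≡⟨ cong₂ ℕ._+_ covered (sym (degree≡count Γ∖M v)) ⟩
    suc (degree Γ∖M v) ∎
    where
    open ≡-Reasoning
    matched : ∀ w → adj Γ v w ∧ memE Γ M v w ≡ memE Γ M v w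
    matched w with memE Γ M v w in vw
    ... | true = cong (_∧ true) (perfectMatching⇒adj Γ matching v w vw)
    ... | false = 𝔹.∧-zeroʳ (adj Γ v w)
    covered : count (memE Γ M v) ≡ 1
    covered = trans (sym (countB≡count (memE Γ M v))) (proj₂ matching v)

perfectMatching-deleteEdges : ∀ Γ M {M′} → PerfectMatching (deleteEdges Γ M) M′ → PerfectMatching Γ M′
perfectMatching-deleteEdges Γ M (inΓ∖M , covers) =
  (λ u v u<v uv → proj₁ (∧≡true (inΓ∖M u v u<v uv))) , covers

feasible-deleteEdges : ∀ Γ M {y} → Feasible Γ y → Feasible (deleteEdges Γ M) y
feasible-deleteEdges Γ M (nonNegative , covered) =
  (λ u v edge → nonNegative u v (edge-deleteEdges u v edge)) ,
  (λ M′ matching → covered M′ (perfectMatching-deleteEdges Γ M matching))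
  where
  edge-deleteEdges : ∀ u v → isEdge (deleteEdges Γ M) u v ≡ true → isEdge Γ u v ≡ true
  edge-deleteEdges u v edge with ∧≡true {lt u v} edge
  ... | u<v , uv = cong₂ _∧_ u<v (proj₁ (∧≡true uv))

bipartite-deleteEdges : ∀ Γ M → Bipartite Γ → Bipartite (deleteEdges Γ M)
bipartite-deleteEdges Γ M (colour , proper) = colour , λ u v uv → proper u v (proj₁ (∧≡true uv))

module RegularBipartite (Γ : Graph) (colour : Fin (n Γ) → Bool)
  (proper : ∀ u v → adj Γ u v ≡ true → colour u ≢ colour v)
  (k : ℕ) (regular : ∀ v → degree Γ v ≡ suc k) where

  open import Algebra.Properties.Semiring.Sum ℕP.+-*-semiring using (*-distribʳ-sum)

  private
    V = Fin (n Γ)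
    A = adj Γ
    d = suc k

  count-row : ∀ i → count (A i) ≡ d
  count-row i = trans (sym (degree≡count Γ i)) (regular i)

  count-column : ∀ j → count (λ i → A i j) ≡ d
  count-column j = trans (count-cong (λ i → adj-sym Γ i j)) (count-row j)

  count*d : ∀ (S : V → Bool) → ℕΣ.sum (λ i → 𝟙 (S i) ℕ.* d) ≡ count S ℕ.* d
  count*d S = sym (*-distribʳ-sum d (𝟙 ∘ S))

  edgesFrom : (V → Bool) → ℕ
  edgesFrom S = ℕΣ.sum (λ i → count (λ j → S i ∧ A i j))

  edgesFrom≡rows : ∀ S → edgesFrom S ≡ count S ℕ.* d
  edgesFrom≡rows S = trans (ℕΣ.sum-cong row) (count*d S)
    where
    row : ∀ i → count (λ j → S i ∧ A i j) ≡ 𝟙 (S i) ℕ.* d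
    row i with S i
    ... | true = trans (count-row i) (sym (ℕP.*-identityˡ d))
    ... | false = count-false {p = λ j → false ∧ A i j} (λ _ → refl)

  edgesFrom≡columns : ∀ S → edgesFrom S ≡ ℕΣ.sum (λ j → count (λ i → S i ∧ A i j))
  edgesFrom≡columns S = ℕΣ.∑-comm (λ i j → 𝟙 (S i ∧ A i j))

  -- The d·|S| edges leaving S all end in N(S), which receives at most d·|N(S)| edges.
  hallCondition : ∀ L → HallCondition L A
  hallCondition L S _ = ℕP.*-cancelʳ-≤ (count S) (count (neighbours A S)) d (begin
    count S ℕ.* d                                       ≡⟨ edgesFrom≡rows S ⟨
    edgesFrom S                                         ≡⟨ edgesFrom≡columns S ⟩
    ℕΣ.sum (λ j → count (λ i → S i ∧ A i j))            ≤⟨ ∑ℕ-mono-≤ column ⟩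
    ℕΣ.sum (λ j → 𝟙 (neighbours A S j) ℕ.* d)           ≡⟨ count*d (neighbours A S) ⟩
    count (neighbours A S) ℕ.* d ∎)
    where
    open ℕP.≤-Reasoning
    column : ∀ j → count (λ i → S i ∧ A i j) ℕ.≤ 𝟙 (neighbours A S j) ℕ.* d
    column j with neighbours A S j in N
    ... | true = ℕP.≤-trans (count-mono (λ i → proj₂ ∘ ∧≡true {S i}))
                            (ℕP.≤-reflexive (trans (count-column j) (sym (ℕP.*-identityˡ d))))
    ... | false = ℕP.≤-reflexive (count-false (anyᵇ≡false (λ i → S i ∧ A i j) N))

  colour-balanced : count colour ≡ count (not ∘ colour)
  colour-balanced = ℕP.*-cancelʳ-≡ (count colour) (count (not ∘ colour)) d (begin
    count colour ℕ.* d                                  ≡⟨ edgesFrom≡rows colour ⟨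
    edgesFrom colour                                    ≡⟨ edgesFrom≡columns colour ⟩
    ℕΣ.sum (λ j → count (λ i → colour i ∧ A i j))      ≡⟨ ℕΣ.sum-cong column ⟩
    ℕΣ.sum (λ j → 𝟙 (not (colour j)) ℕ.* d)            ≡⟨ count*d (not ∘ colour) ⟩
    count (not ∘ colour) ℕ.* d ∎)
    where
    open ≡-Reasoning
    column : ∀ j → count (λ i → colour i ∧ A i j) ≡ 𝟙 (not (colour j)) ℕ.* d
    column j with colour j in cj
    ... | true = count-false opposite
      where
      opposite : ∀ i → colour i ∧ A i j ≡ false
      opposite i with A i j in ij | colour i in ci
      ... | true | true = ⊥-elim (proper i j ij (trans ci (sym cj)))
      ... | true | false = refl
      ... | false | c = 𝔹.∧-zeroʳ c
    ... | false = trans (count-cong opposite) (trans (count-column j) (sym (ℕP.*-identityˡ d)))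
      where
      opposite : ∀ i → colour i ∧ A i j ≡ A i j
      opposite i with A i j in ij | colour i in ci
      ... | true | true = refl
      ... | true | false = ⊥-elim (proper i j ij (trans ci (sym cj)))
      ... | false | c = 𝔹.∧-zeroʳ c

-- With colour classes of equal size, an injection f from one class into its neighbours is onto
-- the other class, so the edges {i, f i} form a perfect matching.
module MatchingFromRepresentatives (Γ : Graph) (colour : Fin (n Γ) → Bool)
  (proper : ∀ u v → adj Γ u v ≡ true → colour u ≢ colour v)
  (colour-balanced : count colour ≡ count (not ∘ colour))
  (f : Fin (n Γ) → Fin (n Γ)) (f-represents : Hall.Represents colour (adj Γ) f) where

  private
    V = Fin (n Γ)
    A = adj Γ

  f-adjacent : ∀ i → colour i ≡ true → A i (f i) ≡ true
  f-adjacent = proj₁ f-represents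

  f-injective : ∀ i j → colour i ≡ true → colour j ≡ true → f i ≡ f j → i ≡ j
  f-injective = proj₂ f-represents

  f-crosses : ∀ i → colour i ≡ true → colour (f i) ≡ false
  f-crosses i ci with colour (f i) in cfi
  ... | false = refl
  ... | true = ⊥-elim (proper i (f i) (f-adjacent i ci) (trans ci (sym cfi)))

  infix 4 _↦_

  _↦_ : V → V → Bool
  w ↦ v = colour w ∧ (f w == v)

  ↦-sound : ∀ {w v} → (w ↦ v) ≡ true → colour w ≡ true × f w ≡ v
  ↦-sound {w} {v} hit = proj₁ (∧≡true hit) , ==⇒≡ (f w) v (proj₂ (∧≡true hit))

  ↦-crosses : ∀ {w v} → (w ↦ v) ≡ true → colour v ≡ false
  ↦-crosses hit with ↦-sound hit
  ... | cw , refl = f-crosses _ cw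

  image : V → Bool
  image j = anyᵇ (_↦ j)

  count-colour≤image : count colour ℕ.≤ count image
  count-colour≤image = begin
    count colour                           ≡⟨ ℕΣ.sum-cong row ⟩
    ℕΣ.sum (λ i → count (λ j → i ↦ j))    ≡⟨ ℕΣ.∑-comm (λ i j → 𝟙 (i ↦ j)) ⟩
    ℕΣ.sum (λ j → count (_↦ j))           ≤⟨ ∑ℕ-mono-≤ column ⟩
    count image ∎
    where
    open ℕP.≤-Reasoning
    row : ∀ i → 𝟙 (colour i) ≡ count (λ j → i ↦ j)
    row i with colour i
    ... | true = sym (count-δ (f i))
    ... | false = sym (count-false {p = λ j → false ∧ (f i == j)} (λ _ → refl))
    column : ∀ j → count (_↦ j) ℕ.≤ 𝟙 (image j)
    column j with image j in imj
    ... | true = count≤1 (_↦ j) λ i i′ hit hit′ →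
      f-injective i i′ (proj₁ (↦-sound hit)) (proj₁ (↦-sound hit′))
        (trans (proj₂ (↦-sound hit)) (sym (proj₂ (↦-sound hit′))))
    ... | false = ℕP.≤-reflexive (count-false (anyᵇ≡false (_↦ j) imj))

  f-onto : ∀ j → colour j ≡ false → Σ V λ i → (i ↦ j) ≡ true
  f-onto j cj = anyᵇ-witness (_↦ j) j∈image
    where
    image⊆other : image ⊆ not ∘ colour
    image⊆other j imj = cong not (↦-crosses (proj₂ (anyᵇ-witness (_↦ j) imj)))
    j∈image = ⊆∧count≥⇒⊇ image⊆other (subst (ℕ._≤ count image) colour-balanced count-colour≤image) j (cong not cj)

  matching : EdgeSet Γ
  matching u v = (u ↦ v) ∨ (v ↦ u)

  private
    ↦≡false : ∀ w v → colour v ≡ true → (w ↦ v) ≡ false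
    ↦≡false w v cv with w ↦ v in hit
    ... | false = refl
    ... | true = ⊥-elim (true≢false (trans (sym cv) (↦-crosses hit)))

  matching-irrefl : ∀ v → matching v v ≡ false
  matching-irrefl v with v ↦ v in hit
  ... | false = refl
  ... | true = ⊥-elim (true≢false (trans (sym (proj₁ (↦-sound hit))) (↦-crosses hit)))

  matching⊆adj : ∀ u v → matching u v ≡ true → A u v ≡ true
  matching⊆adj u v uv with u ↦ v in hit
  ... | true with ↦-sound hit
  ...   | cu , refl = f-adjacent u cu
  matching⊆adj u v uv | false with ↦-sound uv
  ...   | cv , refl = trans (adj-sym Γ (f v) v) (f-adjacent v cv)

  count-matching : ∀ v → count (matching v) ≡ 1
  count-matching v with colour v in cv
  ... | true = trans (count-cong (λ w → trans (cong ((f v == w) ∨_) (↦≡false w v cv)) (𝔹.∨-identityʳ (f v == w))))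
                     (count-δ (f v))
  ... | false = count-unique (_↦ v) i i↦v unique
    where
    i = proj₁ (f-onto v cv)
    i↦v = proj₂ (f-onto v cv)
    unique : ∀ w → (w ↦ v) ≡ true → w ≡ i
    unique w hit = f-injective w i (proj₁ (↦-sound hit)) (proj₁ (↦-sound i↦v))
                     (trans (proj₂ (↦-sound hit)) (sym (proj₂ (↦-sound i↦v))))

  perfectMatching : PerfectMatching Γ matching
  perfectMatching = (λ u v _ → matching⊆adj u v) , covers
    where
    memE≡matching : ∀ u v → memE Γ matching u v ≡ matching u v
    memE≡matching = memE-symmetric Γ matching (λ u v → 𝔹.∨-comm (u ↦ v) (v ↦ u)) matching-irrefl
    covers : ∀ v → countB (memE Γ matching v) ≡ 1
    covers v = trans (countB≡count (memE Γ matching v)) (trans (count-cong (memE≡matching v)) (count-matching v))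

regularBipartite⇒perfectMatching : ∀ Γ k → Bipartite Γ → (∀ v → degree Γ v ≡ suc k) →
  Σ (EdgeSet Γ) (PerfectMatching Γ)
regularBipartite⇒perfectMatching Γ k (colour , proper) regular = matching , perfectMatching
  where
  open RegularBipartite Γ colour proper k regular using (hallCondition; colour-balanced)
  representatives = hall colour (adj Γ) (hallCondition colour)
  open MatchingFromRepresentatives Γ colour proper colour-balanced (proj₁ representatives) (proj₂ representatives)

regularBipartite⇒degree≤objective : ∀ k Γ → Bipartite Γ → (∀ v → degree Γ v ≡ k) →
  ∀ y → Feasible Γ y → toℚ k ≤ objective Γ y
regularBipartite⇒degree≤objective zero Γ _ _ y feasible = objective-nonNegative Γ y feasible
regularBipartite⇒degree≤objective (suc k) Γ bipartite regular y feasible = begin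
  toℚ (suc k)                                    ≡⟨ toℚ-+ 1 k ⟩
  1ℚ + toℚ k                                     ≤⟨ ℚP.+-mono-≤ (proj₂ feasible M matching) remainder ⟩
  incidenceDot Γ M y + objective (deleteEdges Γ M) y ≡⟨ objective-deleteEdges Γ matching y ⟨
  objective Γ y ∎
  where
  open ℚP.≤-Reasoning
  M = proj₁ (regularBipartite⇒perfectMatching Γ k bipartite regular)
  matching = proj₂ (regularBipartite⇒perfectMatching Γ k bipartite regular)
  remainder : toℚ k ≤ objective (deleteEdges Γ M) y
  remainder = regularBipartite⇒degree≤objective k (deleteEdges Γ M) (bipartite-deleteEdges Γ M bipartite)
    (λ v → ℕP.suc-injective (trans (sym (degree-deleteEdges Γ matching v)) (regular v)))
    y (feasible-deleteEdges Γ M feasible)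

star : (Γ : Graph) → Fin (n Γ) → Weights Γ
star Γ x u v = if (x == u) ∨ (x == v) then 1ℚ else 0ℚ

sumOver-star : ∀ Γ S x → sumOver Γ S (star Γ x) ≡ toℚ (count (memE Γ S x))
sumOver-star Γ S x = begin
  sumOver Γ S (star Γ x)
    ≡⟨ sumOver≡∑ Γ S (star Γ x) ⟩
  ∑[ u < n Γ ] ∑[ v < n Γ ] edgeTerm Γ S (star Γ x) u v
    ≡⟨ ℚΣ.sum-cong (λ u → trans (ℚΣ.sum-cong (split u)) (ℚΣ.∑-distrib-+ (atSource u) (atTarget u))) ⟩
  ∑[ u < n Γ ] (∑[ v < n Γ ] atSource u v + ∑[ v < n Γ ] atTarget u v)
    ≡⟨ ℚΣ.∑-distrib-+ (λ u → ∑[ v < n Γ ] atSource u v) (λ u → ∑[ v < n Γ ] atTarget u v) ⟩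
  ∑[ u < n Γ ] ∑[ v < n Γ ] atSource u v + ∑[ u < n Γ ] ∑[ v < n Γ ] atTarget u v
    ≡⟨ cong₂ _+_ (trans (ℚΣ.sum-cong (λ u → ℚΣ.sum-if (x == u) (one u)))
                        (ℚΣ.sum-δ x (λ u → ∑[ v < n Γ ] one u v)))
                 (ℚΣ.sum-cong (λ u → ℚΣ.sum-δ x (one u))) ⟩
  ∑[ v < n Γ ] one x v + ∑[ v < n Γ ] one v x
    ≡⟨ ℚΣ.∑-distrib-+ (one x) (λ v → one v x) ⟨
  ∑[ v < n Γ ] (one x v + one v x)
    ≡⟨ ℚΣ.sum-cong incident ⟩
  ∑[ v < n Γ ] toℚ (𝟙 (memE Γ S x v))
    ≡⟨ toℚ-sum (𝟙 ∘ memE Γ S x) ⟨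
  toℚ (count (memE Γ S x)) ∎
  where
  open ≡-Reasoning
  one atSource atTarget : Fin (n Γ) → Fin (n Γ) → ℚ
  one = edgeTerm Γ S (λ _ _ → 1ℚ)
  atSource u v = if x == u then one u v else 0ℚ
  atTarget u v = if x == v then one u v else 0ℚ
  split : ∀ u v → edgeTerm Γ S (star Γ x) u v ≡ atSource u v + atTarget u v
  split u v with x == u in xu | x == v in xv | lt u v ∧ S u v in uv
  ... | true | true | true = ⊥-elim (true≢false (trans (sym (proj₁ (∧≡true uv)))
          (subst (λ w → lt u w ≡ false) (trans (sym (==⇒≡ x u xu)) (==⇒≡ x v xv)) (lt-irrefl u))))
  ... | true | true | false = refl
  ... | true | false | true = refl
  ... | true | false | false = refl
  ... | false | true | true = refl
  ... | false | true | false = refl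
  ... | false | false | true = refl
  ... | false | false | false = refl
  incident : ∀ v → one x v + one v x ≡ toℚ (𝟙 (memE Γ S x v))
  incident v with lt x v ∧ S x v in xv | lt v x ∧ S v x in vx
  ... | true | true = ⊥-elim (true≢false (trans (sym (proj₁ (∧≡true vx))) (lt-asym x v (proj₁ (∧≡true xv)))))
  ... | true | false = refl
  ... | false | true = refl
  ... | false | false = refl

feasible-star : ∀ Γ x → Feasible Γ (star Γ x)
feasible-star Γ x = nonNegative , covered
  where
  nonNegative : ∀ u v → isEdge Γ u v ≡ true → 0ℚ ≤ star Γ x u v
  nonNegative u v _ with (x == u) ∨ (x == v)
  ... | true = ℚP.nonNegative⁻¹ _
  ... | false = ℚP.≤-refl
  covered : ∀ M → PerfectMatching Γ M → 1ℚ ≤ incidenceDot Γ M (star Γ x)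
  covered M (_ , covers) = ℚP.≤-reflexive (sym (begin
    sumOver Γ M (star Γ x)        ≡⟨ sumOver-star Γ M x ⟩
    toℚ (count (memE Γ M x))      ≡⟨ cong toℚ (countB≡count (memE Γ M x)) ⟨
    toℚ (countB (memE Γ M x))     ≡⟨ cong toℚ (covers x) ⟩
    1ℚ ∎))
    where open ≡-Reasoning

objective-star : ∀ Γ x → objective Γ (star Γ x) ≡ toℚ (degree Γ x)
objective-star Γ x = begin
  sumOver Γ (adj Γ) (star Γ x)    ≡⟨ sumOver-star Γ (adj Γ) x ⟩
  toℚ (count (memE Γ (adj Γ) x))  ≡⟨ cong toℚ (count-cong (memE-symmetric Γ (adj Γ) (adj-sym Γ) (adj-irrefl Γ) x)) ⟩
  toℚ (count (adj Γ x))           ≡⟨ cong toℚ (degree≡count Γ x) ⟨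
  toℚ (degree Γ x) ∎
  where open ≡-Reasoning

mpf≤degree : ∀ Γ {r} → IsMpf Γ r → ∀ x → r ≤ toℚ (degree Γ x)
mpf≤degree Γ (_ , minimal) x = subst (_ ≤_) (objective-star Γ x) (minimal (star Γ x) (feasible-star Γ x))

feasible⇒vertex : ∀ Γ {y} → Feasible Γ y → Fin (n Γ)
feasible⇒vertex Γ {y} (_ , covered) = inhabited (n Γ) hasVertex
  where
  inhabited : ∀ m → ¬ ¬ Fin m → Fin m
  inhabited zero ¬¬v = ⊥-elim (¬¬v λ ())
  inhabited (suc m) _ = zero
  noEdges : EdgeSet Γ
  noEdges _ _ = false
  hasVertex : ¬ ¬ Fin (n Γ)
  hasVertex noVertex =
    ℚP.<-irrefl refl (ℚP.<-≤-trans (ℚP.positive⁻¹ 1ℚ) (subst (1ℚ ≤_) emptySum (covered noEdges noEdgesPerfect)))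
    where
    noEdgesPerfect : PerfectMatching Γ noEdges
    noEdgesPerfect = (λ u → ⊥-elim (noVertex u)) , (λ v → ⊥-elim (noVertex v))
    emptySum : incidenceDot Γ noEdges y ≡ 0ℚ
    emptySum = trans (sumOver≡∑ Γ noEdges y) (ℚΣ.sum-empty _ noVertex)

if-∧-pull : ∀ {A : Set} l a b (v z : A) → (if l ∧ (a ∧ b) then v else z) ≡ (if a then (if l ∧ b then v else z) else z)
if-∧-pull true true b v z = refl
if-∧-pull true false b v z = refl
if-∧-pull false true b v z = refl
if-∧-pull false false b v z = refl

module CartesianProduct (G H : Graph) where

  private
    P = G □ H
    K = n H

  pair : Fin (n G) → Fin (n H) → Fin (n P)
  pair = combine

  first : Fin (n P) → Fin (n G)
  first x = proj₁ (remQuot {n G} K x)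

  second : Fin (n P) → Fin (n H)
  second x = proj₂ (remQuot {n G} K x)

  pair-cover : ∀ (Q : Fin (n P) → Set) → (∀ g h → Q (pair g h)) → ∀ x → Q x
  pair-cover Q q x = subst Q (FinP.combine-remQuot {n G} K x) (q (first x) (second x))

  liftG : EdgeSet G → EdgeSet P
  liftG S x x′ = S (first x) (first x′) ∧ (second x == second x′)

  liftH : EdgeSet H → EdgeSet P
  liftH S x x′ = (first x == first x′) ∧ S (second x) (second x′)

  adj-□ : ∀ x x′ → adj P x x′ ≡ liftH (adj H) x x′ ∨ liftG (adj G) x x′
  adj-□ x x′ = refl

  first-pair : ∀ g h → first (pair g h) ≡ g
  first-pair g h = cong proj₁ (FinP.remQuot-combine g h)

  second-pair : ∀ g h → second (pair g h) ≡ h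
  second-pair g h = cong proj₂ (FinP.remQuot-combine g h)

  liftG-pair : ∀ S g h g′ h′ → liftG S (pair g h) (pair g′ h′) ≡ S g g′ ∧ (h == h′)
  liftG-pair S g h g′ h′ rewrite first-pair g h | first-pair g′ h′ | second-pair g h | second-pair g′ h′ = refl

  liftH-pair : ∀ S g h g′ h′ → liftH S (pair g h) (pair g′ h′) ≡ (g == g′) ∧ S h h′
  liftH-pair S g h g′ h′ rewrite first-pair g h | first-pair g′ h′ | second-pair g h | second-pair g′ h′ = refl

  lt-pairˡ : ∀ g g′ h → lt (pair g h) (pair g′ h) ≡ lt g g′
  lt-pairˡ g g′ h with FinP.<-cmp g g′
  ... | tri< g<g′ _ _ = trans (lt-true (FinP.combine-monoˡ-< h h g<g′)) (sym (lt-true g<g′))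
  ... | tri≈ _ refl _ = trans (lt-irrefl (pair g h)) (sym (lt-irrefl g))
  ... | tri> _ _ g′<g = trans (lt-false (FinP.<-asym (FinP.combine-monoˡ-< h h g′<g))) (sym (lt-false (FinP.<-asym g′<g)))

  pair-monoʳ : ∀ g {h h′} → h Fin.< h′ → pair g h Fin.< pair g h′
  pair-monoʳ g {h} {h′} h<h′ = subst₂ ℕ._<_ (sym (FinP.toℕ-combine g h)) (sym (FinP.toℕ-combine g h′))
                                 (ℕP.+-monoʳ-< (K ℕ.* Fin.toℕ g) h<h′)

  lt-pairʳ : ∀ g h h′ → lt (pair g h) (pair g h′) ≡ lt h h′
  lt-pairʳ g h h′ with FinP.<-cmp h h′
  ... | tri< h<h′ _ _ = trans (lt-true (pair-monoʳ g h<h′)) (sym (lt-true h<h′))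
  ... | tri≈ _ refl _ = trans (lt-irrefl (pair g h)) (sym (lt-irrefl h))
  ... | tri> _ _ h′<h = trans (lt-false (FinP.<-asym (pair-monoʳ g h′<h))) (sym (lt-false (FinP.<-asym h′<h)))

  projectG : Weights P → Weights G
  projectG y g g′ = ∑[ h < n H ] y (pair g h) (pair g′ h)

  projectH : Weights P → Weights H
  projectH y h h′ = ∑[ g < n G ] y (pair g h) (pair g h′)

  sumOver-pairs : ∀ S y → sumOver P S y ≡
    ∑[ g < n G ] ∑[ h < n H ] ∑[ g′ < n G ] ∑[ h′ < n H ] edgeTerm P S y (pair g h) (pair g′ h′)
  sumOver-pairs S y = trans (sumOver≡∑ P S y)
    (trans (ℚΣ.sum-combine (n G) K (λ x → ∑[ x′ < n P ] edgeTerm P S y x x′))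
           (ℚΣ.sum-cong λ g → ℚΣ.sum-cong λ h → ℚΣ.sum-combine (n G) K (edgeTerm P S y (pair g h))))

  sumOver-liftG : ∀ S y → sumOver P (liftG S) y ≡ sumOver G S (projectG y)
  sumOver-liftG S y = begin
    sumOver P (liftG S) y
      ≡⟨ sumOver-pairs (liftG S) y ⟩
    ∑[ g < n G ] ∑[ h < n H ] ∑[ g′ < n G ] ∑[ h′ < n H ] edgeTerm P (liftG S) y (pair g h) (pair g′ h′)
      ≡⟨ ℚΣ.sum-cong (λ g → ℚΣ.sum-cong λ h → ℚΣ.sum-cong λ g′ → alongH g h g′) ⟩
    ∑[ g < n G ] ∑[ h < n H ] ∑[ g′ < n G ] along g g′ h
      ≡⟨ ℚΣ.sum-cong (λ g → ℚΣ.∑-comm (λ h g′ → along g g′ h)) ⟩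
    ∑[ g < n G ] ∑[ g′ < n G ] ∑[ h < n H ] along g g′ h
      ≡⟨ ℚΣ.sum-cong (λ g → ℚΣ.sum-cong λ g′ → ℚΣ.sum-if (lt g g′ ∧ S g g′) (λ h → y (pair g h) (pair g′ h))) ⟩
    ∑[ g < n G ] ∑[ g′ < n G ] edgeTerm G S (projectG y) g g′
      ≡⟨ sumOver≡∑ G S (projectG y) ⟨
    sumOver G S (projectG y) ∎
    where
    open ≡-Reasoning
    along : Fin (n G) → Fin (n G) → Fin (n H) → ℚ
    along g g′ h = if lt g g′ ∧ S g g′ then y (pair g h) (pair g′ h) else 0ℚ
    alongH : ∀ g h g′ → ∑[ h′ < n H ] edgeTerm P (liftG S) y (pair g h) (pair g′ h′) ≡ along g g′ h
    alongH g h g′ = begin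
      ∑[ h′ < n H ] edgeTerm P (liftG S) y (pair g h) (pair g′ h′)
        ≡⟨ ℚΣ.sum-cong (λ h′ → trans
             (edgeTerm-cong P {liftG S} {λ _ _ → (h == h′) ∧ S g g′} y (pair g h) (pair g′ h′)
               (trans (liftG-pair S g h g′ h′) (𝔹.∧-comm (S g g′) (h == h′))))
             (if-∧-pull (lt (pair g h) (pair g′ h′)) (h == h′) (S g g′) _ _)) ⟩
      ∑[ h′ < n H ] (if h == h′ then edgeTerm P (λ _ _ → S g g′) y (pair g h) (pair g′ h′) else 0ℚ)
        ≡⟨ ℚΣ.sum-δ h (λ h′ → edgeTerm P (λ _ _ → S g g′) y (pair g h) (pair g′ h′)) ⟩
      edgeTerm P (λ _ _ → S g g′) y (pair g h) (pair g′ h)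
        ≡⟨ cong (λ b → if b ∧ S g g′ then y (pair g h) (pair g′ h) else 0ℚ) (lt-pairˡ g g′ h) ⟩
      along g g′ h ∎

  sumOver-liftH : ∀ S y → sumOver P (liftH S) y ≡ sumOver H S (projectH y)
  sumOver-liftH S y = begin
    sumOver P (liftH S) y
      ≡⟨ sumOver-pairs (liftH S) y ⟩
    ∑[ g < n G ] ∑[ h < n H ] ∑[ g′ < n G ] ∑[ h′ < n H ] edgeTerm P (liftH S) y (pair g h) (pair g′ h′)
      ≡⟨ ℚΣ.sum-cong (λ g → ℚΣ.sum-cong λ h → alongG g h) ⟩
    ∑[ g < n G ] ∑[ h < n H ] ∑[ h′ < n H ] along g h h′
      ≡⟨ ℚΣ.∑-comm (λ g h → ∑[ h′ < n H ] along g h h′) ⟩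
    ∑[ h < n H ] ∑[ g < n G ] ∑[ h′ < n H ] along g h h′
      ≡⟨ ℚΣ.sum-cong (λ h → ℚΣ.∑-comm (λ g h′ → along g h h′)) ⟩
    ∑[ h < n H ] ∑[ h′ < n H ] ∑[ g < n G ] along g h h′
      ≡⟨ ℚΣ.sum-cong (λ h → ℚΣ.sum-cong λ h′ → ℚΣ.sum-if (lt h h′ ∧ S h h′) (λ g → y (pair g h) (pair g h′))) ⟩
    ∑[ h < n H ] ∑[ h′ < n H ] edgeTerm H S (projectH y) h h′
      ≡⟨ sumOver≡∑ H S (projectH y) ⟨
    sumOver H S (projectH y) ∎
    where
    open ≡-Reasoning
    along : Fin (n G) → Fin (n H) → Fin (n H) → ℚ
    along g h h′ = if lt h h′ ∧ S h h′ then y (pair g h) (pair g h′) else 0ℚ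
    alongG : ∀ g h → ∑[ g′ < n G ] ∑[ h′ < n H ] edgeTerm P (liftH S) y (pair g h) (pair g′ h′) ≡
                     ∑[ h′ < n H ] along g h h′
    alongG g h = begin
      ∑[ g′ < n G ] ∑[ h′ < n H ] edgeTerm P (liftH S) y (pair g h) (pair g′ h′)
        ≡⟨ ℚΣ.sum-cong (λ g′ → trans (ℚΣ.sum-cong λ h′ → trans
             (edgeTerm-cong P {liftH S} {λ _ _ → (g == g′) ∧ S h h′} y (pair g h) (pair g′ h′) (liftH-pair S g h g′ h′))
             (if-∧-pull (lt (pair g h) (pair g′ h′)) (g == g′) (S h h′) _ _))
           (ℚΣ.sum-if (g == g′) (λ h′ → edgeTerm P (λ _ _ → S h h′) y (pair g h) (pair g′ h′)))) ⟩
      ∑[ g′ < n G ] (if g == g′ then ∑[ h′ < n H ] edgeTerm P (λ _ _ → S h h′) y (pair g h) (pair g′ h′) else 0ℚ)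
        ≡⟨ ℚΣ.sum-δ g (λ g′ → ∑[ h′ < n H ] edgeTerm P (λ _ _ → S h h′) y (pair g h) (pair g′ h′)) ⟩
      ∑[ h′ < n H ] edgeTerm P (λ _ _ → S h h′) y (pair g h) (pair g h′)
        ≡⟨ ℚΣ.sum-cong (λ h′ → cong (λ b → if b ∧ S h h′ then y (pair g h) (pair g h′) else 0ℚ)
                                    (lt-pairʳ g h h′)) ⟩
      ∑[ h′ < n H ] along g h h′ ∎

  count-pairs : ∀ (p : Fin (n P) → Bool) → count p ≡ ℕΣ.sum (λ g → count (λ h → p (pair g h)))
  count-pairs p = ℕΣ.sum-combine (n G) K (𝟙 ∘ p)

  count-liftG : ∀ T g h → count (liftG T (pair g h)) ≡ count (T g)
  count-liftG T g h = trans (count-pairs (liftG T (pair g h))) (ℕΣ.sum-cong λ g′ → trans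
    (ℕΣ.sum-cong (λ h′ → cong 𝟙 (liftG-pair T g h g′ h′)))
    (trans (ℕΣ.sum-cong (𝟙-∧ʳ (T g g′) ∘ (h ==_))) (ℕΣ.sum-δ h (λ _ → 𝟙 (T g g′)))))

  count-liftH : ∀ T g h → count (liftH T (pair g h)) ≡ count (T h)
  count-liftH T g h = trans (count-pairs (liftH T (pair g h))) (trans (ℕΣ.sum-cong λ g′ → trans
    (ℕΣ.sum-cong (λ h′ → trans (cong 𝟙 (liftH-pair T g h g′ h′)) (𝟙-∧ˡ (g == g′) (T h h′))))
    (ℕΣ.sum-if (g == g′) (𝟙 ∘ T h)))
    (ℕΣ.sum-δ g (λ _ → count (T h))))

  memE-liftG : ∀ M x x′ → memE P (liftG M) x x′ ≡ liftG (memE G M) x x′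
  memE-liftG M = pair-cover _ λ g h → pair-cover _ λ g′ h′ → atPairs g h g′ h′
    where
    atPairs : ∀ g h g′ h′ → memE P (liftG M) (pair g h) (pair g′ h′) ≡ liftG (memE G M) (pair g h) (pair g′ h′)
    atPairs g h g′ h′ rewrite liftG-pair M g h g′ h′ | liftG-pair M g′ h′ g h | liftG-pair (memE G M) g h g′ h′
      with h == h′ in h==h′
    ... | true with ==⇒≡ h h′ h==h′
    ... | refl rewrite ==-refl h | lt-pairˡ g g′ h | lt-pairˡ g′ g h
                     | 𝔹.∧-identityʳ (M g g′) | 𝔹.∧-identityʳ (M g′ g) = sym (𝔹.∧-identityʳ _)
    atPairs g h g′ h′ | false rewrite trans (==-sym h′ h) h==h′ | 𝔹.∧-zeroʳ (M g g′) | 𝔹.∧-zeroʳ (M g′ g)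
      | 𝔹.∧-zeroʳ (lt (pair g h) (pair g′ h′)) | 𝔹.∧-zeroʳ (lt (pair g′ h′) (pair g h)) = sym (𝔹.∧-zeroʳ _)

  memE-liftH : ∀ M x x′ → memE P (liftH M) x x′ ≡ liftH (memE H M) x x′
  memE-liftH M = pair-cover _ λ g h → pair-cover _ λ g′ h′ → atPairs g h g′ h′
    where
    atPairs : ∀ g h g′ h′ → memE P (liftH M) (pair g h) (pair g′ h′) ≡ liftH (memE H M) (pair g h) (pair g′ h′)
    atPairs g h g′ h′ rewrite liftH-pair M g h g′ h′ | liftH-pair M g′ h′ g h | liftH-pair (memE H M) g h g′ h′
      with g == g′ in g==g′
    ... | true with ==⇒≡ g g′ g==g′
    ... | refl rewrite ==-refl g | lt-pairʳ g h h′ | lt-pairʳ g h′ h = refl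
    atPairs g h g′ h′ | false rewrite trans (==-sym g′ g) g==g′
      | 𝔹.∧-zeroʳ (lt (pair g h) (pair g′ h′)) | 𝔹.∧-zeroʳ (lt (pair g′ h′) (pair g h)) = refl

  liftG⊆adj : ∀ {T} → (∀ g g′ → T g g′ ≡ true → adj G g g′ ≡ true) →
    ∀ x x′ → liftG T x x′ ≡ true → adj P x x′ ≡ true
  liftG⊆adj T⊆adj x x′ lifted with ∧≡true lifted
  ... | inT , same = trans (cong (liftH (adj H) x x′ ∨_) (cong₂ _∧_ (T⊆adj _ _ inT) same)) (𝔹.∨-zeroʳ _)

  liftH⊆adj : ∀ {T} → (∀ h h′ → T h h′ ≡ true → adj H h h′ ≡ true) →
    ∀ x x′ → liftH T x x′ ≡ true → adj P x x′ ≡ true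
  liftH⊆adj T⊆adj x x′ lifted with ∧≡true lifted
  ... | same , inT = cong (_∨ liftG (adj G) x x′) (cong₂ _∧_ same (T⊆adj _ _ inT))

  perfectMatching-liftG : ∀ {M} → PerfectMatching G M → PerfectMatching P (liftG M)
  perfectMatching-liftG {M} matching = inP , pair-cover _ covers
    where
    inP : ∀ x x′ → lt x x′ ≡ true → liftG M x x′ ≡ true → adj P x x′ ≡ true
    inP x x′ x<x′ xx′ = liftG⊆adj (perfectMatching⇒adj G matching) x x′
      (trans (sym (memE-liftG M x x′)) (trans (lt⇒memE P (liftG M) x x′ x<x′) xx′))
    covers : ∀ g h → countB (memE P (liftG M) (pair g h)) ≡ 1
    covers g h = begin
      countB (memE P (liftG M) (pair g h))    ≡⟨ countB≡count (memE P (liftG M) (pair g h)) ⟩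
      count (memE P (liftG M) (pair g h))     ≡⟨ count-cong (memE-liftG M (pair g h)) ⟩
      count (liftG (memE G M) (pair g h))     ≡⟨ count-liftG (memE G M) g h ⟩
      count (memE G M g)                      ≡⟨ countB≡count (memE G M g) ⟨
      countB (memE G M g)                     ≡⟨ proj₂ matching g ⟩
      1 ∎
      where open ≡-Reasoning

  perfectMatching-liftH : ∀ {M} → PerfectMatching H M → PerfectMatching P (liftH M)
  perfectMatching-liftH {M} matching = inP , pair-cover _ covers
    where
    inP : ∀ x x′ → lt x x′ ≡ true → liftH M x x′ ≡ true → adj P x x′ ≡ true
    inP x x′ x<x′ xx′ = liftH⊆adj (perfectMatching⇒adj H matching) x x′
      (trans (sym (memE-liftH M x x′)) (trans (lt⇒memE P (liftH M) x x′ x<x′) xx′))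
    covers : ∀ g h → countB (memE P (liftH M) (pair g h)) ≡ 1
    covers g h = begin
      countB (memE P (liftH M) (pair g h))    ≡⟨ countB≡count (memE P (liftH M) (pair g h)) ⟩
      count (memE P (liftH M) (pair g h))     ≡⟨ count-cong (memE-liftH M (pair g h)) ⟩
      count (liftH (memE H M) (pair g h))     ≡⟨ count-liftH (memE H M) g h ⟩
      count (memE H M h)                      ≡⟨ countB≡count (memE H M h) ⟨
      countB (memE H M h)                     ≡⟨ proj₂ matching h ⟩
      1 ∎
      where open ≡-Reasoning

  feasible-projectG : ∀ {y} → Feasible P y → Feasible G (projectG y)
  feasible-projectG {y} (nonNegative , covered) = nonNegativeG , coveredG
    where
    nonNegativeG : ∀ g g′ → isEdge G g g′ ≡ true → 0ℚ ≤ projectG y g g′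
    nonNegativeG g g′ edge with ∧≡true {lt g g′} edge
    ... | g<g′ , gg′ = ∑ℚ-nonNegative λ h → nonNegative (pair g h) (pair g′ h) (cong₂ _∧_
          (trans (lt-pairˡ g g′ h) g<g′)
          (liftG⊆adj (λ _ _ → id) (pair g h) (pair g′ h)
            (trans (liftG-pair (adj G) g h g′ h) (cong₂ _∧_ gg′ (==-refl h)))))
    coveredG : ∀ M → PerfectMatching G M → 1ℚ ≤ incidenceDot G M (projectG y)
    coveredG M matching = subst (1ℚ ≤_) (sumOver-liftG M y) (covered (liftG M) (perfectMatching-liftG matching))

  feasible-projectH : ∀ {y} → Feasible P y → Feasible H (projectH y)
  feasible-projectH {y} (nonNegative , covered) = nonNegativeH , coveredH
    where
    nonNegativeH : ∀ h h′ → isEdge H h h′ ≡ true → 0ℚ ≤ projectH y h h′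
    nonNegativeH h h′ edge with ∧≡true {lt h h′} edge
    ... | h<h′ , hh′ = ∑ℚ-nonNegative λ g → nonNegative (pair g h) (pair g h′) (cong₂ _∧_
          (trans (lt-pairʳ g h h′) h<h′)
          (liftH⊆adj (λ _ _ → id) (pair g h) (pair g h′)
            (trans (liftH-pair (adj H) g h g h′) (cong₂ _∧_ (==-refl g) hh′))))
    coveredH : ∀ M → PerfectMatching H M → 1ℚ ≤ incidenceDot H M (projectH y)
    coveredH M matching = subst (1ℚ ≤_) (sumOver-liftH M y) (covered (liftH M) (perfectMatching-liftH matching))

  liftH-liftG-disjoint : ∀ x x′ → liftH (adj H) x x′ ∧ liftG (adj G) x x′ ≡ false
  liftH-liftG-disjoint x x′ with first x == first x′ in same
  ... | false = refl
  ... | true rewrite ==⇒≡ (first x) (first x′) same | adj-irrefl G (first x′) =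
    𝔹.∧-zeroʳ (adj H (second x) (second x′))

  objective-□ : ∀ y → objective P y ≡ objective G (projectG y) + objective H (projectH y)
  objective-□ y = begin
    sumOver P (adj P) y
      ≡⟨ sumOver-∨ P (liftH (adj H)) (liftG (adj G)) y liftH-liftG-disjoint ⟩
    sumOver P (liftH (adj H)) y + sumOver P (liftG (adj G)) y
      ≡⟨ cong₂ _+_ (sumOver-liftH (adj H) y) (sumOver-liftG (adj G) y) ⟩
    objective H (projectH y) + objective G (projectG y)
      ≡⟨ ℚP.+-comm (objective H (projectH y)) (objective G (projectG y)) ⟩
    objective G (projectG y) + objective H (projectH y) ∎
    where open ≡-Reasoning

  degree-□ : ∀ g h → degree P (pair g h) ≡ degree G g ℕ.+ degree H h
  degree-□ g h = begin
    degree P x                                ≡⟨ degree≡count P x ⟩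
    count (liftH (adj H) x ∪ liftG (adj G) x) ≡⟨ count-∪-disjoint (liftH (adj H) x) (liftG (adj G) x) (liftH-liftG-disjoint x) ⟩
    count (liftH (adj H) x) ℕ.+ count (liftG (adj G) x)
      ≡⟨ cong₂ ℕ._+_ (count-liftH (adj H) g h) (count-liftG (adj G) g h) ⟩
    count (adj H h) ℕ.+ count (adj G g)       ≡⟨ cong₂ ℕ._+_ (degree≡count H h) (degree≡count G g) ⟨
    degree H h ℕ.+ degree G g                 ≡⟨ ℕP.+-comm (degree H h) (degree G g) ⟩
    degree G g ℕ.+ degree H h ∎
    where
    open ≡-Reasoning
    x = pair g h

mpf-□-≥ : ∀ G H {a b c} → IsMpf G a → IsMpf H b → IsMpf (G □ H) c → a + b ≤ c
mpf-□-≥ G H {a} {b} (_ , minimalG) (_ , minimalH) ((y , feasible , optimal) , _) = begin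
  a + b                                               ≤⟨ ℚP.+-mono-≤ (minimalG _ (feasible-projectG feasible))
                                                                     (minimalH _ (feasible-projectH feasible)) ⟩
  objective G (projectG y) + objective H (projectH y) ≡⟨ objective-□ y ⟨
  objective (G □ H) y                                 ≡⟨ optimal ⟩
  _ ∎
  where
  open CartesianProduct G H
  open ℚP.≤-Reasoning

mpf-regularBipartite : ∀ Γ {k r} → Bipartite Γ → (∀ v → degree Γ v ≡ k) → IsMpf Γ r → r ≡ toℚ k
mpf-regularBipartite Γ {k} {r} bipartite regular mpf@((y , feasible , optimal) , _) = ℚP.≤-antisym
  (subst (r ≤_) (cong toℚ (regular x)) (mpf≤degree Γ mpf x))
  (subst (toℚ k ≤_) optimal (regularBipartite⇒degree≤objective k Γ bipartite regular y feasible))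
  where
  x = feasible⇒vertex Γ feasible

/1≡fromℤ : ∀ z → z / 1 ≡ fromℤ z
/1≡fromℤ z = ℚP.↥p/↧p≡p (fromℤ z)

floor-≤ : ∀ b → floor b / 1 ≤ b
floor-≤ b@(mkℚ num den _) = subst (_≤ b) (sym (/1≡fromℤ (floor b))) (*≤* ⌊b⌋*d≤num)
  where
  ⌊b⌋*d≤num : floor b ℤ.* ℤ.+ suc den ℤ.≤ num ℤ.* ℤ.+ 1
  ⌊b⌋*d≤num = subst (floor b ℤ.* ℤ.+ suc den ℤ.≤_) (sym (ℤP.*-identityʳ num)) (ℤ.[n/d]*d≤n num (ℤ.+ suc den))

floor-toℚ : ∀ k → floor (toℚ k) / 1 ≡ toℚ k
floor-toℚ k = trans (/1≡fromℤ (floor (toℚ k))) (cong fromℤ ⌊k⌋≡k)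
  where
  ⌊k⌋≡k : floor (toℚ k) ≡ ℤ.+ k
  ⌊k⌋≡k = trans (cong (λ m → (ℤ.sign (ℤ.+ 1) Sign.* ℤ.sign (ℤ.+ m)) ℤ.◃ (m ℕ.+ 0 ℕ.* m)) (ℕ.n/1≡n k))
                (trans (cong (Sign.+ ℤ.◃_) (ℕP.+-identityʳ k)) (ℤP.+◃n≡+n k))

theorem4p6 : (G H : Graph) → Bipartite G → Bipartite H →
    (a b c : ℚ) → IsMpf G a → IsMpf H b → IsMpf (G □ H) c →
    (a + (floor b / 1) ≤ c) × (Regular G → Regular H → c ≡ a + (floor b / 1))
theorem4p6 G H bipartiteG bipartiteH a b c mpfG mpfH mpf□ =
  ℚP.≤-trans (ℚP.+-monoʳ-≤ a (floor-≤ b)) a+b≤c , regularCase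
  where
  open CartesianProduct G H using (pair; degree-□)
  a+b≤c = mpf-□-≥ G H mpfG mpfH mpf□
  regularCase : Regular G → Regular H → c ≡ a + (floor b / 1)
  regularCase (kG , regularG) (kH , regularH) = ℚP.≤-antisym c≤a+⌊b⌋ (subst (λ t → a + t ≤ c) (sym ⌊b⌋≡b) a+b≤c)
    where
    a≡kG = mpf-regularBipartite G bipartiteG regularG mpfG
    b≡kH = mpf-regularBipartite H bipartiteH regularH mpfH
    ⌊b⌋≡b : floor b / 1 ≡ b
    ⌊b⌋≡b = trans (cong (λ t → floor t / 1) b≡kH) (trans (floor-toℚ kH) (sym b≡kH))
    g = feasible⇒vertex G (proj₁ (proj₂ (proj₁ mpfG)))
    h = feasible⇒vertex H (proj₁ (proj₂ (proj₁ mpfH)))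
    c≤a+⌊b⌋ : c ≤ a + (floor b / 1)
    c≤a+⌊b⌋ = subst (c ≤_) (begin
      toℚ (degree (G □ H) (pair g h))  ≡⟨ cong toℚ (trans (degree-□ g h) (cong₂ ℕ._+_ (regularG g) (regularH h))) ⟩
      toℚ (kG ℕ.+ kH)                  ≡⟨ toℚ-+ kG kH ⟩
      toℚ kG + toℚ kH                  ≡⟨ cong₂ _+_ a≡kG (trans ⌊b⌋≡b b≡kH) ⟨
      a + (floor b / 1) ∎) (mpf≤degree (G □ H) mpf□ (pair g h))
      where open ≡-Reasoning
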